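{- Let $D$ be a finite set, let $\Gamma$ be a valued constraint language over $D$ with $|\Gamma|$ finite, and let $\Gamma_e=\{\mathbb{D}_\Gamma,\mu_\Gamma\}$ be the extended dual of $\Gamma$. Then $\Gamma$ is a rigid core if and only if $\Gamma_e$ is a rigid core.
   Context: Let $\overline{\mathbb{Q}}=\mathbb{Q}\cup\{\infty\}$. An $m$-ary cost function over a finite set $A$ is a map $\phi:A^m\to\overline{\mathbb{Q}}$, with $\mathrm{Feas}(\phi)=\{\mathbf{x}:\phi(\mathbf{x})<\infty\}$; $\mathbf{x}[i]$ is the $i$th component. A binary relation ($\{0,\infty\}$-valued cost function) is identified with a digraph. An operation $f:A^k\to A$ is a polymorphism of $\phi$ if it maps $k$-tuples of members of $\mathrm{Feas}(\phi)$ (applied componentwise) into $\mathrm{Feas}(\phi)$; $\mathrm{Pol}^{(k)}(\Gamma)$ is the set of $k$-ary common polymorphisms of all members of $\Gamma$. A $k$-ary fractional polymorphism of $\Gamma$ is a probability distribution $\omega:\mathrm{Pol}^{(k)}(\Gamma)\to\mathbb{Q}_{\ge0}$ with $\sum_f\omega(f)\phi(f(\mathbf{x}_1,\dots,\mathbf{x}_k))\le\frac1k\sum_i\phi(\mathbf{x}_i)$ for all $\phi\in\Gamma$ and $\mathbf{x}_1,\dots,\mathbf{x}_k\in\mathrm{Feas}(\phi)$; $\mathrm{supp}(\Gamma)$ is the set of operations given positive weight by some fractional polymorphism of $\Gamma$; $\Gamma$ is a rigid core if the only unary operation in $\mathrm{supp}(\Gamma)$ is the identity. Combined cost function: for $\Gamma=\{\phi_1,\dots,\phi_q\}$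 (none identically $\infty$) with arities $m_1,\dots,m_q$ and $m=\sum m_i$, $\phi_\Gamma(x_1,\dots,x_m)=\phi_1(x_1,\dots,x_{m_1})+\dots+\phi_q(x_{m-m_q+1},\dots,x_m)$; $D'=\mathrm{Feas}(\phi_\Gamma)\subseteq D^m$. Extended dual: a zigzag is the oriented path $\bullet\to\bullet\leftarrow\bullet\to\bullet$. For $S\subseteq\{1,\dots,m\}$ let $\mathbb{Q}_{S,i}$ be a single edge if $i\in S$ and a zigzag otherwise, and let $\mathbb{Q}_S$ be the concatenation (last vertex identified with next first vertex) of a single edge, $\mathbb{Q}_{S,1},\dots,\mathbb{Q}_{S,m}$, and a single edge. $\mathbb{D}_\Gamma$ is obtained from the digraph on $D\cup D'$ (disjoint union) with edges $D\times D'$ by replacing each edge $(d,\mathbf{x})$ with a copy of $\mathbb{Q}_{\{i:\mathbf{x}[i]=d\}}$ from $d$ to $\mathbf{x}$ with new internal vertices; its vertex set is $V=D\cup D'\cup E$ with $E$ the internal vertices. $\mu_\Gamma(v)=\phi_\Gamma(v)$ for $v\in D'$, $0$ otherwise. $\Gamma_e=\{\mathbb{D}_\Gamma,\mu_\Gamma\}$ is a language over domain $V$. -}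

module Defs where

open import Data.Nat as ℕ using (ℕ; zero; suc; _∸_; NonZero)
open import Data.Integer using (+_)
open import Data.Fin as Fin using (Fin; toℕ)
open import Data.Vec as Vec using (Vec; []; _∷_; lookup; tabulate)
import Data.Vec.Properties as VecP
import Data.Vec.Relation.Unary.All as VAll
open import Data.Rational as ℚ using (ℚ; 0ℚ; 1ℚ)
open import Data.List as List using (List; []; _∷_)
open import Data.List.Relation.Unary.All using (All)
open import Data.List.Relation.Unary.Any using (Any)
open import Data.Product using (Σ; ∃; _×_; _,_; proj₁; proj₂)
open import Data.Bool using (Bool; true; false; T; if_then_else_; _∧_; _∨_)
open import Data.Maybe using (Maybe; just; nothing)
open import Relation.Nullary.Decidable using (⌊_⌋)
open import Relation.Binary.PropositionalEquality using (_≡_)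

data ℚ∞ : Set where
  fin : ℚ → ℚ∞
  ∞   : ℚ∞

infixl 6 _+∞_
_+∞_ : ℚ∞ → ℚ∞ → ℚ∞
fin a +∞ fin b = fin (a ℚ.+ b)
fin _ +∞ ∞     = ∞
∞     +∞ _     = ∞

infixl 7 _·∞_
_·∞_ : ℚ → ℚ∞ → ℚ∞
w ·∞ fin a = fin (w ℚ.* a)
w ·∞ ∞     = ∞

infix 4 _≤∞_
data _≤∞_ : ℚ∞ → ℚ∞ → Set where
  fin≤fin : ∀ {a b} → a ℚ.≤ b → fin a ≤∞ fin b
  any≤∞   : ∀ {a} → a ≤∞ ∞

isFin : ℚ∞ → Bool
isFin (fin _) = true
isFin ∞       = false

CostFun : Set → ℕ → Set
CostFun A m = Vec A m → ℚ∞

Feas : ∀ {A m} → CostFun A m → Vec A m → Set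
Feas φ x = T (isFin (φ x))

Lang : Set → Set
Lang A = List (Σ ℕ (CostFun A))

Op : Set → ℕ → Set
Op A k = Vec A k → A

apply : ∀ {A k m} → Op A k → Vec (Vec A m) k → Vec A m
apply f xs = tabulate (λ j → f (Vec.map (λ x → lookup x j) xs))

IsPolOf : ∀ {A k m} → Op A k → CostFun A m → Set
IsPolOf {A} {k} {m} f φ =
  (xs : Vec (Vec A m) k) → VAll.All (Feas φ) xs → Feas φ (apply f xs)

IsPol : ∀ {A k} → Lang A → Op A k → Set
IsPol Γ f = All (λ p → IsPolOf f (proj₂ p)) Γ

sumℚ : List ℚ → ℚ
sumℚ = List.foldr ℚ._+_ 0ℚ

sum∞ : ∀ {n} → Vec ℚ∞ n → ℚ∞
sum∞ = Vec.foldr _ _+∞_ (fin 0ℚ)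

expect : ∀ {A k m} → List (Op A k × ℚ) → CostFun A m → Vec (Vec A m) k → ℚ∞
expect []             φ xs = fin 0ℚ
expect ((f , w) ∷ ω) φ xs = w ·∞ φ (apply f xs) +∞ expect ω φ xs

-- A k-ary fractional polymorphism: a probability distribution on Pol^(k)(Γ),
-- given as a finite list of (operation, positive weight) pairs with total weight 1
-- (the weight of an operation is the sum of the weights of its entries).
record FracPol {A : Set} (Γ : Lang A) (k : ℕ) .{{_ : NonZero k}} : Set where
  field
    dist  : List (Op A k × ℚ)
    pol   : All (λ e → IsPol Γ (proj₁ e)) dist
    pos   : All (λ e → 0ℚ ℚ.< proj₂ e) dist
    total : sumℚ (List.map proj₂ dist) ≡ 1ℚ
    ineq  : All (λ p → (xs : Vec (Vec A (proj₁ p)) k) → VAll.All (Feas (proj₂ p)) xs →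
                   expect dist (proj₂ p) xs ≤∞ ((+ 1) ℚ./ k) ·∞ sum∞ (Vec.map (proj₂ p) xs)) Γ

open FracPol public

InSupp : ∀ {A} → Lang A → (k : ℕ) .{{_ : NonZero k}} → Op A k → Set
InSupp Γ k f = Σ (FracPol Γ k) (λ ω → Any (λ e → (xs : Vec _ k) → proj₁ e xs ≡ f xs) (dist ω))

RigidCore : ∀ {A} → Lang A → Set
RigidCore {A} Γ = (f : Op A 1) → InSupp Γ 1 f → (a : A) → f (a ∷ []) ≡ a

NoneInfinite : ∀ {A} → Lang A → Set
NoneInfinite Γ = All (λ p → ∃ (λ x → Feas (proj₂ p) x)) Γ

arity : ∀ {A} → Lang A → ℕ
arity []            = 0
arity ((m , _) ∷ Γ) = m ℕ.+ arity Γ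

combined : ∀ {A} (Γ : Lang A) → CostFun A (arity Γ)
combined []            x = fin 0ℚ
combined ((m , φ) ∷ Γ) x = φ (Vec.take m x) +∞ combined Γ (Vec.drop m x)

arcAt : List Bool → ℕ → Maybe Bool
arcAt []       _       = nothing
arcAt (b ∷ _)  zero    = just b
arcAt (_ ∷ bs) (suc t) = arcAt bs t

module ExtendedDual {n : ℕ} (Γ : Lang (Fin n)) where

  m : ℕ
  m = arity Γ

  φΓ : CostFun (Fin n) m
  φΓ = combined Γ

  D' : Set
  D' = Σ (Vec (Fin n) m) (λ x → Feas φΓ x)

  -- arc directions of Q_{S,i} (true = forward, false = backward):
  -- a single edge if x[i] = d, a zigzag → ← → otherwise
  block : Fin n → Fin n → List Bool
  block d c = if ⌊ c Fin.≟ d ⌋ then true ∷ [] else true ∷ false ∷ true ∷ []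

  -- arc directions of Q_S, S = {i : x[i] = d}; arc t joins positions t and t+1
  arcs : Fin n → Vec (Fin n) m → List Bool
  arcs d x = true ∷ (List.concatMap (block d) (Vec.toList x) List.++ (true ∷ []))

  len : Fin n → Vec (Fin n) m → ℕ
  len d x = List.length (arcs d x)

  -- vertices: D ⊎ D' ⊎ E; the internal vertex vE d x k sits at position k+1
  -- of the copy of Q_S from d to x (positions 0 = d, len = x)
  data V : Set where
    vD  : Fin n → V
    vD' : D' → V
    vE  : (d : Fin n) (x : D') → Fin (len d (proj₁ x) ∸ 1) → V

  eqV : Vec (Fin n) m → Vec (Fin n) m → Bool
  eqV x y = ⌊ VecP.≡-dec Fin._≟_ x y ⌋

  posIn : Fin n → Vec (Fin n) m → V → Maybe ℕ
  posIn d x (vD d′) = if ⌊ d′ Fin.≟ d ⌋ then just 0 else nothing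
  posIn d x (vD' (x′ , _)) = if eqV x′ x then just (len d x) else nothing
  posIn d x (vE d′ (x′ , _) k) =
    if ⌊ d′ Fin.≟ d ⌋ ∧ eqV x′ x then just (suc (toℕ k)) else nothing

  isDir : Maybe Bool → Bool → Bool
  isDir (just true)  true  = true
  isDir (just false) false = true
  isDir _            _     = false

  edgeIn : Fin n → Vec (Fin n) m → V → V → Bool
  edgeIn d x u v with posIn d x u | posIn d x v
  ... | just a | just b = (⌊ b ℕ.≟ suc a ⌋ ∧ isDir (arcAt (arcs d x) a) true)
                        ∨ (⌊ a ℕ.≟ suc b ⌋ ∧ isDir (arcAt (arcs d x) b) false)
  ... | _      | _      = false

  -- every edge of 𝔻_Γ has an internal endpoint, which determines its copy
  edge : V → V → Bool
  edge u@(vE d x _) v = edgeIn d (proj₁ x) u v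
  edge u v@(vE d x _) = edgeIn d (proj₁ x) u v
  edge _ _ = false

  𝔻Γ : CostFun V 2
  𝔻Γ (u ∷ v ∷ []) = if edge u v then fin 0ℚ else ∞

  μΓ : CostFun V 1
  μΓ (vD' (x , _) ∷ []) = φΓ x
  μΓ (vD _ ∷ [])        = fin 0ℚ
  μΓ (vE _ _ _ ∷ [])    = fin 0ℚ

  Γe : Lang V
  Γe = (2 , 𝔻Γ) ∷ (1 , μΓ) ∷ []

-- (⇐) A unary polymorphism g of Γ lifts to an endomorphism of 𝔻_Γ acting as g on D and
-- componentwise on D′. Since x[i] = d implies (g x)[i] = g d, the set S only grows, so the copy of
-- Q_S from d to x folds onto the copy of Q_S′ from g d to g x, each zigzag that becomes a single
-- edge being folded back. Lifting the operations of a fractional polymorphism of Γ gives one of Γₑ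
-- (its μ_Γ-inequality on D′ is the combined inequality for Γ), so if Γₑ is a rigid core, every g
-- in supp(Γ) is the identity.
--
-- (⇒) 𝔻_Γ is layered: D at level 0, D′ at level m + 2, internal vertices in between, and every
-- edge goes up one level. Hence an endomorphism H maps D to D, D′ to D′ and each copy of a path Q_S
-- onto a copy, and walking along the copy from x[i] to x shows (H x)[i] = H (x[i]). Restricting a
-- fractional polymorphism of Γₑ to D therefore gives one of Γ: its μ_Γ-inequality is the
-- inequality for φ_Γ, which splits into those of the members of Γ because the summands of φ_Γ
-- have disjoint variables. If Γ is a rigid core the restriction is the identity, so H fixes
-- D ∪ D′, and the walk along each copy forces H to fix it pointwise.

module Submission where

open import Defs
open import Data.Nat using (ℕ)
open import Data.Fin using (Fin)
open import Function.Bundles using (_⇔_; mk⇔; Equivalence)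

open import Algebra.Bundles using (CommutativeMonoid)
import Algebra.Properties.CommutativeSemigroup as CommSemigroupProperties
open import Data.Nat using (zero; suc; _+_; _≤_; _<_; z≤n; s≤s; pred)
import Data.Nat as ℕ
import Data.Nat.Properties as ℕP
open import Data.Integer using (1ℤ)
import Data.Fin as F
import Data.Fin.Properties as FP
open import Data.Vec as Vec using (Vec; []; _∷_; lookup)
import Data.Vec.Properties as VecP
import Data.Vec.Relation.Unary.All as VAll
open import Data.Rational as ℚ using (ℚ; 0ℚ; 1ℚ)
import Data.Rational.Properties as ℚP
open import Data.List as List using (List; []; _∷_)
import Data.List.Properties as ListP
open import Data.List.Relation.Unary.All as All using (All; []; _∷_)
import Data.List.Relation.Unary.All.Properties as AllP
open import Data.List.Relation.Unary.Any using (Any; here; there)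
open import Data.List.Relation.Binary.Pointwise using (Pointwise; []; _∷_)
open import Data.Product using (Σ; _×_; _,_; proj₁; proj₂)
open import Data.Sum as Sum using (_⊎_; inj₁; inj₂; [_,_]′)
open import Data.Bool using (Bool; true; false; T; if_then_else_; _∧_; _∨_)
open import Data.Bool.Properties using (T-≡; T-irrelevant; ∨-zeroʳ)
open import Data.Maybe using (Maybe; just; nothing; fromMaybe)
open import Data.Maybe.Properties using (just-injective)
open import Data.Unit using (⊤; tt)
open import Data.Empty using (⊥; ⊥-elim)
open import Relation.Nullary using (Dec; yes; no)
open import Relation.Nullary.Decidable using (⌊_⌋; fromWitness; toWitness; T?)
open import Relation.Binary.PropositionalEquality
open import Function using (_∘_)

isYes-complete : ∀ {a} {A : Set a} (d : Dec A) → A → ⌊ d ⌋ ≡ true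
isYes-complete d a = Equivalence.to T-≡ (fromWitness {a? = d} a)

isYes-sound : ∀ {a} {A : Set a} (d : Dec A) → ⌊ d ⌋ ≡ true → A
isYes-sound d e = toWitness {a? = d} (Equivalence.from T-≡ e)

∨≡true⇒⊎ : ∀ x y → x ∨ y ≡ true → x ≡ true ⊎ y ≡ true
∨≡true⇒⊎ true  _ _ = inj₁ refl
∨≡true⇒⊎ false _ e = inj₂ e

∧≡true⇒× : ∀ x y → x ∧ y ≡ true → x ≡ true × y ≡ true
∧≡true⇒× true true _ = refl , refl

≤∞-refl : ∀ {a} → a ≤∞ a
≤∞-refl {fin a} = fin≤fin ℚP.≤-refl
≤∞-refl {∞}     = any≤∞

≤∞-reflexive : ∀ {a b} → a ≡ b → a ≤∞ b
≤∞-reflexive refl = ≤∞-refl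

≤∞-trans : ∀ {a b c} → a ≤∞ b → b ≤∞ c → a ≤∞ c
≤∞-trans (fin≤fin p) (fin≤fin q) = fin≤fin (ℚP.≤-trans p q)
≤∞-trans _           any≤∞       = any≤∞

≤∞-total : ∀ a b → a ≤∞ b ⊎ b ≤∞ a
≤∞-total (fin a) (fin b) = Sum.map fin≤fin fin≤fin (ℚP.≤-total a b)
≤∞-total a       ∞       = inj₁ any≤∞
≤∞-total ∞       (fin b) = inj₂ any≤∞

+∞-mono-≤∞ : ∀ {a b c d} → a ≤∞ c → b ≤∞ d → a +∞ b ≤∞ c +∞ d
+∞-mono-≤∞ (fin≤fin p) (fin≤fin q) = fin≤fin (ℚP.+-mono-≤ p q)
+∞-mono-≤∞ (fin≤fin _) any≤∞       = any≤∞
+∞-mono-≤∞ any≤∞       _           = any≤∞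

+∞-comm : ∀ a b → a +∞ b ≡ b +∞ a
+∞-comm (fin a) (fin b) = cong fin (ℚP.+-comm a b)
+∞-comm (fin _) ∞       = refl
+∞-comm ∞       (fin _) = refl
+∞-comm ∞       ∞       = refl

+∞-interchange : ∀ a b c d → (a +∞ b) +∞ (c +∞ d) ≡ (a +∞ c) +∞ (b +∞ d)
+∞-interchange (fin a) (fin b) (fin c) (fin d) = cong fin (interchange a b c d)
  where open CommSemigroupProperties (CommutativeMonoid.commutativeSemigroup ℚP.+-0-commutativeMonoid)
+∞-interchange (fin _) (fin _) (fin _) ∞ = refl
+∞-interchange (fin _) (fin _) ∞       _ = refl
+∞-interchange (fin _) ∞       (fin _) _ = refl
+∞-interchange (fin _) ∞       ∞       _ = refl
+∞-interchange ∞       _       _       _ = refl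

·∞-distrib-+∞ : ∀ w a b → w ·∞ (a +∞ b) ≡ w ·∞ a +∞ w ·∞ b
·∞-distrib-+∞ w (fin a) (fin b) = cong fin (ℚP.*-distribˡ-+ w a b)
·∞-distrib-+∞ w (fin _) ∞       = refl
·∞-distrib-+∞ w ∞       _       = refl

isFin-+∞ : ∀ a b → T (isFin a) → T (isFin b) → T (isFin (a +∞ b))
isFin-+∞ (fin _) (fin _) _ _ = tt

isFin-+∞⁻ : ∀ a b → T (isFin (a +∞ b)) → T (isFin a) × T (isFin b)
isFin-+∞⁻ (fin _) (fin _) _ = tt , tt

average-singleton : ∀ c → (1ℤ ℚ./ 1) ·∞ sum∞ (c ∷ []) ≡ c
average-singleton (fin q) = cong fin (trans (ℚP.*-identityˡ (q ℚ.+ 0ℚ)) (ℚP.+-identityʳ q))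
average-singleton ∞       = refl

+∞-cancelʳ-≤∞ : ∀ a e b c → a +∞ e ≤∞ b +∞ fin c → fin c ≤∞ e → a ≤∞ b
+∞-cancelʳ-≤∞ a       e       ∞       c _            _             = any≤∞
+∞-cancelʳ-≤∞ (fin a) (fin e) (fin b) c (fin≤fin ae≤bc) (fin≤fin c≤e) =
  fin≤fin (subst₂ ℚ._≤_ (cancel a) (cancel b) (ℚP.+-monoˡ-≤ (ℚ.- c) ac≤bc))
  where
  ac≤bc : a ℚ.+ c ℚ.≤ b ℚ.+ c
  ac≤bc = ℚP.≤-trans (ℚP.+-monoʳ-≤ a c≤e) ae≤bc
  cancel : ∀ x → (x ℚ.+ c) ℚ.- c ≡ x
  cancel x = trans (ℚP.+-assoc x c (ℚ.- c))
               (trans (cong (x ℚ.+_) (ℚP.+-inverseʳ c)) (ℚP.+-identityʳ x))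

+∞-cancelˡ-≤∞ : ∀ e a c b → e +∞ a ≤∞ fin c +∞ b → fin c ≤∞ e → a ≤∞ b
+∞-cancelˡ-≤∞ e a c b h =
  +∞-cancelʳ-≤∞ a e b c (subst₂ _≤∞_ (+∞-comm e a) (+∞-comm (fin c) b) h)

fun₁ : ∀ {A} → Op A 1 → A → A
fun₁ f a = f (a ∷ [])

UnaryDist : Set → Set
UnaryDist A = List (Op A 1 × ℚ)

weights : ∀ {A k} → List (Op A k × ℚ) → List ℚ
weights = List.map proj₂

mapOps : ∀ {A B k k'} → (Op A k → Op B k') → List (Op A k × ℚ) → List (Op B k' × ℚ)
mapOps F = List.map (λ e → F (proj₁ e) , proj₂ e)

module _ {A B : Set} {k k'} (F : Op A k → Op B k') where

  weights-mapOps : ∀ ds → weights (mapOps F ds) ≡ weights ds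
  weights-mapOps ds = sym (ListP.map-∘ ds)

  Any-mapOps : ∀ {P : Op A k → Set} {f : Op A k} ds →
               All (P ∘ proj₁) ds → Any (λ e → proj₁ e ≗ f) ds →
               Σ (Op A k) λ g → P g × g ≗ f × Any (λ e → proj₁ e ≗ F g) (mapOps F ds)
  Any-mapOps (_ ∷ ds) (p ∷ _)  (here g≗f) = _ , p , g≗f , here (λ _ → refl)
  Any-mapOps (_ ∷ ds) (_ ∷ ps) (there i)  =
    let (g , p , g≗f , i') = Any-mapOps ds ps i in g , p , g≗f , there i'

  expect-mapOps : ∀ {m m'} (ds : List (Op A k × ℚ)) (ψ : CostFun B m) xs (φ : CostFun A m') ys →
    All (λ e → ψ (apply (F (proj₁ e)) xs) ≡ φ (apply (proj₁ e) ys)) ds →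
    expect (mapOps F ds) ψ xs ≡ expect ds φ ys
  expect-mapOps []            ψ xs φ ys []       = refl
  expect-mapOps ((g , w) ∷ ds) ψ xs φ ys (e ∷ es) =
    cong₂ (λ a b → w ·∞ a +∞ b) e (expect-mapOps ds ψ xs φ ys es)

module _ {A : Set} where

  apply-unary : ∀ {m} (f : Op A 1) (x : Vec A m) → apply f (x ∷ []) ≡ Vec.map (fun₁ f) x
  apply-unary f x =
    trans (VecP.tabulate-∘ (fun₁ f) (lookup x)) (cong (Vec.map (fun₁ f)) (VecP.tabulate∘lookup x))

  take-++ : ∀ {m k} (y : Vec A m) (w : Vec A k) → Vec.take m (y Vec.++ w) ≡ y
  take-++ []      w = refl
  take-++ (c ∷ y) w = cong (c ∷_) (take-++ y w)

  drop-++ : ∀ {m k} (y : Vec A m) (w : Vec A k) → Vec.drop m (y Vec.++ w) ≡ w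
  drop-++ []      w = refl
  drop-++ (c ∷ y) w = drop-++ y w

  expect-zero : ∀ {m} (ω : UnaryDist A) (φ : CostFun A m) xs →
                All (λ e → φ (apply (proj₁ e) xs) ≡ fin 0ℚ) ω → expect ω φ xs ≡ fin 0ℚ
  expect-zero []            φ xs []       = refl
  expect-zero ((f , w) ∷ ω) φ xs (z ∷ zs) rewrite z | expect-zero ω φ xs zs =
    cong fin (trans (ℚP.+-identityʳ (w ℚ.* 0ℚ)) (ℚP.*-zeroʳ w))

  expect-split : ∀ {m k} (ω : UnaryDist A) (φ : CostFun A m) (ψ : CostFun A k) (x : Vec A (m + k)) →
    expect ω (λ z → φ (Vec.take m z) +∞ ψ (Vec.drop m z)) (x ∷ [])
      ≡ expect ω φ (Vec.take m x ∷ []) +∞ expect ω ψ (Vec.drop m x ∷ [])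
  expect-split []                φ ψ x = refl
  expect-split {m} ((f , w) ∷ ω) φ ψ x =
    trans (cong₂ _+∞_ (trans (cong (w ·∞_) (cong₂ _+∞_ (cong φ take-apply) (cong ψ drop-apply)))
                             (·∞-distrib-+∞ w _ _))
                      (expect-split ω φ ψ x))
          (+∞-interchange _ _ _ _)
    where
    take-apply : Vec.take m (apply f (x ∷ [])) ≡ apply f (Vec.take m x ∷ [])
    take-apply = trans (cong (Vec.take m) (apply-unary f x))
                   (trans (VecP.take-map (fun₁ f) m x) (sym (apply-unary f _)))
    drop-apply : Vec.drop m (apply f (x ∷ [])) ≡ apply f (Vec.drop m x ∷ [])
    drop-apply = trans (cong (Vec.drop m) (apply-unary f x))
                   (trans (VecP.drop-map (fun₁ f) m x) (sym (apply-unary f _)))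

  expect-lowerBound : ∀ {m} (ω : UnaryDist A) (φ : CostFun A m) xs c →
    All (λ e → 0ℚ ℚ.≤ proj₂ e) ω → (∀ f → fin c ≤∞ φ (apply f xs)) →
    fin (sumℚ (weights ω) ℚ.* c) ≤∞ expect ω φ xs
  expect-lowerBound []            φ xs c _        _ = ≤∞-reflexive (cong fin (ℚP.*-zeroˡ c))
  expect-lowerBound ((f , w) ∷ ω) φ xs c (w≥0 ∷ ws) h =
    subst (_≤∞ w ·∞ φ (apply f xs) +∞ expect ω φ xs)
      (cong fin (sym (ℚP.*-distribʳ-+ c w (sumℚ (weights ω)))))
      (+∞-mono-≤∞ (scaled (φ (apply f xs)) (h f)) (expect-lowerBound ω φ xs c ws h))
    where
    scaled : ∀ a → fin c ≤∞ a → fin (w ℚ.* c) ≤∞ w ·∞ a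
    scaled (fin a) (fin≤fin c≤a) = fin≤fin (ℚP.*-monoˡ-≤-nonNeg w {{ℚ.nonNegative w≥0}} c≤a)
    scaled ∞       _             = any≤∞

  combined-∷-++ : ∀ {m} (φ : CostFun A m) (Γ : Lang A) y w →
                  combined ((m , φ) ∷ Γ) (y Vec.++ w) ≡ φ y +∞ combined Γ w
  combined-∷-++ φ Γ y w = cong₂ _+∞_ (cong φ (take-++ y w)) (cong (combined Γ) (drop-++ y w))

  combined-feasible-++ : ∀ {m} (φ : CostFun A m) (Γ : Lang A) y w →
    Feas φ y → Feas (combined Γ) w → Feas (combined ((m , φ) ∷ Γ)) (y Vec.++ w)
  combined-feasible-++ φ Γ y w fy fw =
    subst (T ∘ isFin) (sym (combined-∷-++ φ Γ y w)) (isFin-+∞ _ _ fy fw)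

  combined-feasible : (Γ : Lang A) → NoneInfinite Γ → Σ (Vec A (arity Γ)) (Feas (combined Γ))
  combined-feasible []            []              = [] , tt
  combined-feasible ((m , φ) ∷ Γ) ((y , fy) ∷ ni) =
    let (w , fw) = combined-feasible Γ ni in y Vec.++ w , combined-feasible-++ φ Γ y w fy fw

  PreservesCombined : Lang A → (A → A) → Set
  PreservesCombined Γ g = ∀ x → Feas (combined Γ) x → Feas (combined Γ) (Vec.map g x)

  pol⇒preservesCombined : (Γ : Lang A) (f : Op A 1) → IsPol Γ f → PreservesCombined Γ (fun₁ f)
  pol⇒preservesCombined []            f []        x fx = tt
  pol⇒preservesCombined ((m , φ) ∷ Γ) f (fφ ∷ fΓ) x fx =
    let (fa , fb) = isFin-+∞⁻ (φ (Vec.take m x)) _ fx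
    in isFin-+∞ _ _
         (subst (Feas φ) (trans (apply-unary f _) (sym (VecP.take-map (fun₁ f) m x)))
           (fφ (Vec.take m x ∷ []) (fa VAll.∷ VAll.[])))
         (subst (Feas (combined Γ)) (sym (VecP.drop-map (fun₁ f) m x))
           (pol⇒preservesCombined Γ f fΓ (Vec.drop m x) fb))

  -- Each summand is tested against a fixed feasible tuple of the others.
  preservesCombined⇒pol : (Γ : Lang A) (f : Op A 1) → NoneInfinite Γ →
                          PreservesCombined Γ (fun₁ f) → IsPol Γ f
  preservesCombined⇒pol []            f []               h = []
  preservesCombined⇒pol ((m , φ) ∷ Γ) f ((y₀ , fy₀) ∷ ni) h =
    head ∷ preservesCombined⇒pol Γ f ni tail
    where
    w₀ = proj₁ (combined-feasible Γ ni)
    head : IsPolOf f φ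
    head (y ∷ []) (fy VAll.∷ VAll.[]) =
      subst (Feas φ) (trans (VecP.take-map (fun₁ f) m (y Vec.++ w₀))
                       (trans (cong (Vec.map (fun₁ f)) (take-++ y w₀)) (sym (apply-unary f y))))
        (proj₁ (isFin-+∞⁻ _ _ (h (y Vec.++ w₀)
          (combined-feasible-++ φ Γ y w₀ fy (proj₂ (combined-feasible Γ ni))))))
    tail : PreservesCombined Γ (fun₁ f)
    tail x fx =
      subst (Feas (combined Γ)) (trans (VecP.drop-map (fun₁ f) m (y₀ Vec.++ x))
                                  (cong (Vec.map (fun₁ f)) (drop-++ y₀ x)))
        (proj₂ (isFin-+∞⁻ _ _ (h (y₀ Vec.++ x) (combined-feasible-++ φ Γ y₀ x fy₀ fx))))

  UnaryIneq : ∀ {m} → UnaryDist A → CostFun A m → Set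
  UnaryIneq {m} ω φ = (xs : Vec (Vec A m) 1) → VAll.All (Feas φ) xs →
                      expect ω φ xs ≤∞ (1ℤ ℚ./ 1) ·∞ sum∞ (Vec.map φ xs)

  CombinedIneq : Lang A → UnaryDist A → Set
  CombinedIneq Γ ω = ∀ x → Feas (combined Γ) x → expect ω (combined Γ) (x ∷ []) ≤∞ combined Γ x

  expect-combined-++ : ∀ {m} (ω : UnaryDist A) (φ : CostFun A m) (Γ : Lang A) y w →
    expect ω (combined ((m , φ) ∷ Γ)) ((y Vec.++ w) ∷ [])
      ≡ expect ω φ (y ∷ []) +∞ expect ω (combined Γ) (w ∷ [])
  expect-combined-++ ω φ Γ y w =
    trans (expect-split ω φ (combined Γ) (y Vec.++ w))
      (cong₂ _+∞_ (cong (λ z → expect ω φ (z ∷ [])) (take-++ y w))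
                  (cong (λ z → expect ω (combined Γ) (z ∷ [])) (drop-++ y w)))

  unaryIneqs⇒combinedIneq : (Γ : Lang A) (ω : UnaryDist A) →
                            All (λ p → UnaryIneq ω (proj₂ p)) Γ → CombinedIneq Γ ω
  unaryIneqs⇒combinedIneq []            ω []        x fx =
    ≤∞-reflexive (expect-zero ω (λ _ → fin 0ℚ) (x ∷ []) (All.universal (λ _ → refl) ω))
  unaryIneqs⇒combinedIneq ((m , φ) ∷ Γ) ω (iφ ∷ iΓ) x fx =
    let (fa , fb) = isFin-+∞⁻ (φ (Vec.take m x)) _ fx in
    subst (_≤∞ combined ((m , φ) ∷ Γ) x) (sym (expect-split ω φ (combined Γ) x))
      (+∞-mono-≤∞ (subst (expect ω φ (Vec.take m x ∷ []) ≤∞_) (average-singleton (φ (Vec.take m x)))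
                    (iφ (Vec.take m x ∷ []) (fa VAll.∷ VAll.[])))
                  (unaryIneqs⇒combinedIneq Γ ω iΓ (Vec.drop m x) fb))

argmin-Fin : ∀ {k} → Fin k → (ψ : Fin k → ℚ∞) → Σ (Fin k) (λ w → ∀ v → ψ w ≤∞ ψ v)
argmin-Fin {suc zero}    _ ψ = F.zero , λ { F.zero → ≤∞-refl }
argmin-Fin {suc (suc k)} _ ψ with argmin-Fin {suc k} F.zero (ψ ∘ F.suc)
... | (w , w-min) with ≤∞-total (ψ F.zero) (ψ (F.suc w))
...   | inj₁ p = F.zero , λ { F.zero → ≤∞-refl ; (F.suc v) → ≤∞-trans p (w-min v) }
...   | inj₂ p = F.suc w , λ { F.zero → p ; (F.suc v) → w-min v }

argmin-Vec : ∀ {n k} → Vec (Fin n) k → (ψ : Vec (Fin n) k → ℚ∞) →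
             Σ (Vec (Fin n) k) (λ w → ∀ v → ψ w ≤∞ ψ v)
argmin-Vec []               ψ = [] , λ { [] → ≤∞-refl }
argmin-Vec {n} {suc k} (c ∷ w₀) ψ =
  a ∷ proj₁ (tailMin a) , λ { (b ∷ v) → ≤∞-trans (a-min b) (proj₂ (tailMin b) v) }
  where
  tailMin : (a : Fin n) → Σ (Vec (Fin n) k) (λ w → ∀ v → ψ (a ∷ w) ≤∞ ψ (a ∷ v))
  tailMin a = argmin-Vec w₀ (λ t → ψ (a ∷ t))
  headMin = argmin-Fin c (λ a → ψ (a ∷ proj₁ (tailMin a)))
  a = proj₁ headMin
  a-min = proj₂ headMin

record Minimiser {n k} (ψ : CostFun (Fin n) k) : Set where
  field
    point   : Vec (Fin n) k
    value   : ℚ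
    attains : ψ point ≡ fin value
    minimal : ∀ v → fin value ≤∞ ψ v

  feasible : Feas ψ point
  feasible = subst (T ∘ isFin) (sym attains) tt

minimiser : ∀ {n k} (ψ : CostFun (Fin n) k) (w₀ : Vec (Fin n) k) → Feas ψ w₀ → Minimiser ψ
minimiser ψ w₀ fw₀ with argmin-Vec w₀ ψ
... | w , w-min with ψ w in eq | w-min w₀
...   | fin c | _ = record { point = w ; value = c ; attains = eq
                           ; minimal = λ v → subst (_≤∞ ψ v) eq (w-min v) }
...   | ∞     | ∞≤ψw₀ = ⊥-elim (infeasible ∞≤ψw₀ fw₀)
  where
  infeasible : ∀ {a} → ∞ ≤∞ a → T (isFin a) → ⊥
  infeasible any≤∞ ()

module _ {n : ℕ} where

  minimiser≤expect : ∀ {k} (ω : UnaryDist (Fin n)) (ψ : CostFun (Fin n) k) (M : Minimiser ψ) →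
    All (λ e → 0ℚ ℚ.≤ proj₂ e) ω → sumℚ (weights ω) ≡ 1ℚ →
    fin (Minimiser.value M) ≤∞ expect ω ψ (Minimiser.point M ∷ [])
  minimiser≤expect ω ψ M ω≥0 ω-total =
    subst (_≤∞ expect ω ψ (point ∷ []))
      (cong fin (trans (cong (ℚ._* value) ω-total) (ℚP.*-identityˡ value)))
      (expect-lowerBound ω ψ (point ∷ []) value ω≥0 (λ f → minimal _))
    where open Minimiser M

  -- Fixing all other summands at a minimiser cancels them from the combined inequality.
  combinedIneq⇒unaryIneqs : (Γ : Lang (Fin n)) (ω : UnaryDist (Fin n)) → NoneInfinite Γ →
    All (λ e → 0ℚ ℚ.≤ proj₂ e) ω → sumℚ (weights ω) ≡ 1ℚ →
    CombinedIneq Γ ω → All (λ p → UnaryIneq ω (proj₂ p)) Γ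
  combinedIneq⇒unaryIneqs []            ω []               ω≥0 ω-total ineq = []
  combinedIneq⇒unaryIneqs ((m , φ) ∷ Γ) ω ((y₀ , fy₀) ∷ ni) ω≥0 ω-total ineq =
    head ∷ combinedIneq⇒unaryIneqs Γ ω ni ω≥0 ω-total tail
    where
    Mφ : Minimiser φ
    Mφ = minimiser φ y₀ fy₀
    MΓ : Minimiser (combined Γ)
    MΓ = minimiser (combined Γ) (proj₁ (combined-feasible Γ ni)) (proj₂ (combined-feasible Γ ni))
    open Minimiser

    ineq-++ : ∀ y w → Feas φ y → Feas (combined Γ) w →
              expect ω φ (y ∷ []) +∞ expect ω (combined Γ) (w ∷ []) ≤∞ φ y +∞ combined Γ w
    ineq-++ y w fy fw = subst₂ _≤∞_ (expect-combined-++ ω φ Γ y w) (combined-∷-++ φ Γ y w)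
                          (ineq (y Vec.++ w) (combined-feasible-++ φ Γ y w fy fw))

    head : UnaryIneq ω φ
    head (y ∷ []) (fy VAll.∷ VAll.[]) =
      subst (expect ω φ (y ∷ []) ≤∞_) (sym (average-singleton (φ y)))
        (+∞-cancelʳ-≤∞ _ _ _ (value MΓ)
          (≤∞-trans (ineq-++ y (point MΓ) fy (feasible MΓ))
                    (≤∞-reflexive (cong (φ y +∞_) (attains MΓ))))
          (minimiser≤expect ω (combined Γ) MΓ ω≥0 ω-total))

    tail : CombinedIneq Γ ω
    tail x fx =
      +∞-cancelˡ-≤∞ _ _ (value Mφ) _
        (≤∞-trans (ineq-++ (point Mφ) x (feasible Mφ) fx)
                  (≤∞-reflexive (cong (_+∞ combined Γ x) (attains Mφ))))
        (minimiser≤expect ω φ Mφ ω≥0 ω-total)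

-- Oriented paths given by their arc directions

-- A list L of directions describes the oriented path on positions 0 … length L
-- whose t-th arc joins positions t and t+1, pointing forwards iff it is true.
data Arc (L : List Bool) (a b : ℕ) : Set where
  forward  : b ≡ suc a → arcAt L a ≡ just true  → Arc L a b
  backward : a ≡ suc b → arcAt L b ≡ just false → Arc L a b

Arc-∷ : ∀ {x L a b} → Arc L a b → Arc (x ∷ L) (suc a) (suc b)
Arc-∷ (forward  e t) = forward  (cong suc e) t
Arc-∷ (backward e f) = backward (cong suc e) f

forward≢backward : ∀ {A : Set} {x : Maybe Bool} → x ≡ just true → x ≡ just false → A
forward≢backward e f with () ← just-injective (trans (sym e) f)

arcAt-< : ∀ L i {b} → arcAt L i ≡ just b → i < List.length L
arcAt-< (_ ∷ L) zero    _ = s≤s z≤n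
arcAt-< (_ ∷ L) (suc i) e = s≤s (arcAt-< L i e)

arcAt-just : ∀ L i → i < List.length L → Σ Bool (λ b → arcAt L i ≡ just b)
arcAt-just (x ∷ L) zero    _       = x , refl
arcAt-just (x ∷ L) (suc i) (s≤s p) = arcAt-just L i p

arcAt-++ : ∀ P M i → arcAt (P List.++ M) (List.length P + i) ≡ arcAt M i
arcAt-++ []      M i = refl
arcAt-++ (_ ∷ P) M i = arcAt-++ P M i

Arc-endpoints-≤ : ∀ {L a b} → Arc L a b → a ≤ List.length L × b ≤ List.length L
Arc-endpoints-≤ {L} {a} (forward refl t) = let a< = arcAt-< L a t in ℕP.<⇒≤ a< , a<
Arc-endpoints-≤ {L} {_} {b} (backward refl f) = let b< = arcAt-< L b f in b< , ℕP.<⇒≤ b<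

Arc-from-0 : ∀ {L y} → Arc L 0 y → y ≡ 1
Arc-from-0 (forward refl _) = refl

Arc-into-suc : ∀ {L j y} → Arc L y (suc j) →
  (y ≡ j × arcAt L j ≡ just true) ⊎ (y ≡ suc (suc j) × arcAt L (suc j) ≡ just false)
Arc-into-suc (forward  refl t) = inj₁ (refl , t)
Arc-into-suc (backward refl f) = inj₂ (refl , f)

Arc-out-of-suc : ∀ {L p y} → Arc L (suc p) y →
  (y ≡ suc (suc p) × arcAt L (suc p) ≡ just true) ⊎ (y ≡ p × arcAt L p ≡ just false)
Arc-out-of-suc (forward  refl t) = inj₁ (refl , t)
Arc-out-of-suc (backward refl f) = inj₂ (refl , f)

record Hom (L L' : List Bool) : Set where
  field
    map     : ℕ → ℕ
    map-0   : map 0 ≡ 0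
    map-end : map (List.length L) ≡ List.length L'
    map-<   : ∀ a → a < List.length L → map a < List.length L'
    map-arc : ∀ a b → Arc L a b → Arc L' (map a) (map b)

Hom-[] : Hom [] []
Hom-[] = record { map = λ a → a ; map-0 = refl ; map-end = refl ; map-< = λ _ ()
                ; map-arc = λ { _ _ (forward _ ()) ; _ _ (backward _ ()) } }

Hom-∷ : ∀ x {L L'} → Hom L L' → Hom (x ∷ L) (x ∷ L')
Hom-∷ x {L} {L'} H = record { map = map′ ; map-0 = refl ; map-end = cong suc (map-end H)
                            ; map-< = map′-< ; map-arc = map′-arc }
  where
  open Hom
  map′ : ℕ → ℕ
  map′ zero    = zero
  map′ (suc a) = suc (map H a)
  map′-< : ∀ a → a < suc (List.length L) → map′ a < suc (List.length L')
  map′-< zero    _       = s≤s z≤n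
  map′-< (suc a) (s≤s p) = s≤s (map-< H a p)
  map′-arc : ∀ a b → Arc (x ∷ L) a b → Arc (x ∷ L') (map′ a) (map′ b)
  map′-arc zero     .1               (forward refl e)  = forward (cong suc (map-0 H)) e
  map′-arc (suc a)  .(suc (suc a))   (forward refl e)  = Arc-∷ (map-arc H a (suc a) (forward refl e))
  map′-arc .1       zero             (backward refl e) = backward (cong suc (map-0 H)) e
  map′-arc .(suc (suc b)) (suc b)    (backward refl e) = Arc-∷ (map-arc H (suc b) b (backward refl e))

-- The zigzag → ← → is folded onto a single edge: its second and third vertices go back and forth.
Hom-fold : ∀ {L L'} → 0 < List.length L → Hom L L' → Hom (true ∷ false ∷ true ∷ L) (true ∷ L')
Hom-fold {L} {L'} L≢[] H = record { map = map′ ; map-0 = refl ; map-end = cong suc (map-end H)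
                                   ; map-< = map′-< ; map-arc = map′-arc }
  where
  open Hom
  map′ : ℕ → ℕ
  map′ zero                = zero
  map′ (suc zero)          = suc zero
  map′ (suc (suc zero))    = zero
  map′ (suc (suc (suc a))) = suc (map H a)
  map′-< : ∀ a → a < suc (suc (suc (List.length L))) → map′ a < suc (List.length L')
  map′-< zero                _                      = s≤s z≤n
  map′-< (suc zero)          _                      = s≤s (subst (_< List.length L') (map-0 H) (map-< H 0 L≢[]))
  map′-< (suc (suc zero))    _                      = s≤s z≤n
  map′-< (suc (suc (suc a))) (s≤s (s≤s (s≤s p))) = s≤s (map-< H a p)
  map′-arc : ∀ a b → Arc (true ∷ false ∷ true ∷ L) a b → Arc (true ∷ L') (map′ a) (map′ b)
  map′-arc zero                .1  (forward refl _)  = forward refl refl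
  map′-arc (suc zero)          .2  (forward refl ())
  map′-arc (suc (suc zero))    .3  (forward refl _)  = forward (cong suc (map-0 H)) refl
  map′-arc (suc (suc (suc a))) .(suc (suc (suc (suc a)))) (forward refl e) =
    Arc-∷ (map-arc H a (suc a) (forward refl e))
  map′-arc .1 zero                (backward refl ())
  map′-arc .2 (suc zero)          (backward refl _) = forward refl refl
  map′-arc .3 (suc (suc zero))    (backward refl ())
  map′-arc .(suc (suc (suc (suc b)))) (suc (suc (suc b))) (backward refl e) =
    Arc-∷ (map-arc H (suc b) b (backward refl e))

-- The i-th block of a path Q_S: a single edge if i ∈ S (true), a zigzag otherwise.
segment : Bool → List Bool
segment b = if b then true ∷ [] else true ∷ false ∷ true ∷ []

-- Q_S without its first edge.
pathArcs : List Bool → List Bool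
pathArcs bs = List.concatMap segment bs List.++ (true ∷ [])

pathArcs-head : ∀ bs → arcAt (pathArcs bs) 0 ≡ just true
pathArcs-head []          = refl
pathArcs-head (true ∷ _)  = refl
pathArcs-head (false ∷ _) = refl

pathArcs-∷ : ∀ b bs → pathArcs (b ∷ bs) ≡ segment b List.++ pathArcs bs
pathArcs-∷ b bs = ListP.++-assoc (segment b) (List.concatMap segment bs) (true ∷ [])

_⊆ᵇ_ : List Bool → List Bool → Set
_⊆ᵇ_ = Pointwise (λ b b' → T b → T b')

pathArcs-≢[] : ∀ bs → 0 < List.length (pathArcs bs)
pathArcs-≢[] bs rewrite ListP.length-++ (List.concatMap segment bs) {true ∷ []} =
  subst (0 <_) (ℕP.+-comm 1 _) (s≤s z≤n)

Hom-⊆ᵇ : ∀ {bs bs'} → bs ⊆ᵇ bs' → Hom (pathArcs bs) (pathArcs bs')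
Hom-⊆ᵇ []                                = Hom-∷ true Hom-[]
Hom-⊆ᵇ (_∷_ {true}  {true}          _ s) = Hom-∷ true (Hom-⊆ᵇ s)
Hom-⊆ᵇ (_∷_ {true}  {false}         p s) = ⊥-elim (p tt)
Hom-⊆ᵇ (_∷_ {false} {true}  {bs}    _ s) = Hom-fold (pathArcs-≢[] bs) (Hom-⊆ᵇ s)
Hom-⊆ᵇ (_∷_ {false} {false}         _ s) = Hom-∷ true (Hom-∷ false (Hom-∷ true (Hom-⊆ᵇ s)))

height : ℕ → List Bool → ℕ → ℕ
height c L           zero    = c
height c []          (suc p) = c
height c (true ∷ L)  (suc p) = height (suc c) L p
height c (false ∷ L) (suc p) = height (pred c) L p

-- The positivity hypothesis excludes a backward arc into height 0, where pred truncates.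
height-arc : ∀ c L a b → Arc L a b → 0 < height c L b → height c L b ≡ suc (height c L a)
height-arc c       (true ∷ L)  zero    .1             (forward refl _)  _  = refl
height-arc c       (true ∷ L)  (suc a) .(suc (suc a)) (forward refl e)  h =
  height-arc (suc c) L a (suc a) (forward refl e) h
height-arc c       (false ∷ L) (suc a) .(suc (suc a)) (forward refl e)  h =
  height-arc (pred c) L a (suc a) (forward refl e) h
height-arc zero    (false ∷ L) .1      zero           (backward refl _) ()
height-arc (suc c) (false ∷ L) .1      zero           (backward refl _) _  = refl
height-arc c       (true ∷ L)  .(suc (suc b)) (suc b) (backward refl e) h =
  height-arc (suc c) L (suc b) b (backward refl e) h
height-arc c       (false ∷ L) .(suc (suc b)) (suc b) (backward refl e) h =
  height-arc (pred c) L (suc b) b (backward refl e) h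

height-end : ∀ bs c → height c (pathArcs bs) (List.length (pathArcs bs)) ≡ List.length bs + suc c
height-end []          c = refl
height-end (true ∷ bs)  c = trans (height-end bs (suc c)) (ℕP.+-suc (List.length bs) (suc c))
height-end (false ∷ bs) c = trans (height-end bs (suc c)) (ℕP.+-suc (List.length bs) (suc c))

height-≥ : ∀ bs c p → c ≤ height c (pathArcs bs) p
height-≥ bs           c zero                = ℕP.≤-refl
height-≥ []           c (suc zero)          = ℕP.n≤1+n c
height-≥ []           c (suc (suc p))       = ℕP.n≤1+n c
height-≥ (true ∷ bs)  c (suc p)             = ℕP.≤-trans (ℕP.n≤1+n c) (height-≥ bs (suc c) p)
height-≥ (false ∷ bs) c (suc zero)          = ℕP.n≤1+n c
height-≥ (false ∷ bs) c (suc (suc zero))    = ℕP.≤-refl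
height-≥ (false ∷ bs) c (suc (suc (suc p))) = ℕP.≤-trans (ℕP.n≤1+n c) (height-≥ bs (suc c) p)

height-< : ∀ bs c p → p < List.length (pathArcs bs) → height c (pathArcs bs) p ≤ List.length bs + c
height-< []           c zero                _ = ℕP.≤-refl
height-< []           c (suc p)             (s≤s ())
height-< (true ∷ bs)  c zero                _ = ℕP.m≤n+m c _
height-< (true ∷ bs)  c (suc p)             (s≤s q) =
  subst (height (suc c) (pathArcs bs) p ≤_) (ℕP.+-suc (List.length bs) c) (height-< bs (suc c) p q)
height-< (false ∷ bs) c zero                _ = ℕP.m≤n+m c _
height-< (false ∷ bs) c (suc zero)          _ = s≤s (ℕP.m≤n+m c _)
height-< (false ∷ bs) c (suc (suc zero))    _ = ℕP.m≤n+m c _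
height-< (false ∷ bs) c (suc (suc (suc p))) (s≤s (s≤s (s≤s q))) =
  subst (height (suc c) (pathArcs bs) p ≤_) (ℕP.+-suc (List.length bs) c) (height-< bs (suc c) p q)

height-arc-Q : ∀ bs a b → Arc (true ∷ pathArcs bs) a b →
               height 0 (true ∷ pathArcs bs) b ≡ suc (height 0 (true ∷ pathArcs bs) a)
height-arc-Q bs a b ab = height-arc 0 (true ∷ pathArcs bs) a b ab (positive b ab)
  where
  positive : ∀ b → Arc (true ∷ pathArcs bs) a b → 0 < height 0 (true ∷ pathArcs bs) b
  positive zero    (backward refl ())
  positive (suc b) _ = height-≥ bs 1 b

Reads : List Bool → ℕ → List Bool → Set
Reads L k M = ∀ i → arcAt L (i + k) ≡ arcAt M i

+-rearrange : ∀ s i k → (s + i) + k ≡ i + (s + k)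
+-rearrange s i k = trans (cong (_+ k) (ℕP.+-comm s i)) (ℕP.+-assoc i s k)

Reads-segment : ∀ L k b bs → Reads L k (pathArcs (b ∷ bs)) →
                Reads L (List.length (segment b) + k) (pathArcs bs)
Reads-segment L k b bs r i =
  trans (cong (arcAt L) (sym (+-rearrange (List.length (segment b)) i k)))
    (trans (r (List.length (segment b) + i))
      (trans (cong (λ M → arcAt M (List.length (segment b) + i)) (pathArcs-∷ b bs))
        (arcAt-++ (segment b) (pathArcs bs) i)))

length-pathArcs-∷ : ∀ b bs →
  List.length (pathArcs (b ∷ bs)) ≡ List.length (segment b) + List.length (pathArcs bs)
length-pathArcs-∷ b bs = trans (cong List.length (pathArcs-∷ b bs)) (ListP.length-++ (segment b))

≤-+-cases : ∀ {P : ℕ → Set} s t → (∀ i → i < s → P i) → (∀ i → i ≤ t → P (s + i)) →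
            ∀ i → i ≤ s + t → P i
≤-+-cases zero    t below above i       i≤t     = above i i≤t
≤-+-cases (suc s) t below above zero    _       = below zero (s≤s z≤n)
≤-+-cases {P} (suc s) t below above (suc i) (s≤s i≤) =
  ≤-+-cases {P ∘ suc} s t (λ i i<s → below (suc i) (s≤s i<s)) above i i≤

-- W is read as a homomorphism from the path L to the path L' that maps the start of the
-- current block of L to the start of the current block of L' (both entered by a forward arc).
module Walk (L L' : List Bool) (W : ℕ → ℕ) (W-arc : ∀ a b → Arc L a b → Arc L' (W a) (W b)) where

  follow-forward : ∀ {q p} → W q ≡ suc p → arcAt L q ≡ just true → arcAt L' p ≡ just true →
                   W (suc q) ≡ suc (suc p) × arcAt L' (suc p) ≡ just true
  follow-forward {q} Wq t t' with subst (λ z → Arc L' z (W (suc q))) Wq (W-arc q (suc q) (forward refl t))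
  ... | forward  e    t″ = e , t″
  ... | backward refl f  = forward≢backward t' f

  record Aligned (bs bs' : List Bool) (k j : ℕ) : Set where
    field
      reads  : Reads L k (pathArcs bs)
      reads' : Reads L' (suc j) (pathArcs bs')
      entry' : arcAt L' j ≡ just true
      W-k    : W k ≡ suc j

  record BlockStep (b b' : Bool) (bs bs' : List Bool) (k j : ℕ) : Set where
    field
      implies : T b → T b'
      next    : Aligned bs bs' (List.length (segment b) + k) (List.length (segment b') + j)
      fixes   : b ≡ b' → ∀ i → i < List.length (segment b) → W (i + k) ≡ i + suc j

  single-step : ∀ b' bs bs' k j → Aligned (true ∷ bs) (b' ∷ bs') k j → BlockStep true b' bs bs' k j
  single-step b' bs bs' k j al = step b' reads'
    where
    open Aligned al
    s1 = follow-forward W-k (reads 0) entry'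
    s2 = follow-forward (proj₁ s1) (trans (reads 1) (pathArcs-head bs)) (proj₂ s1)
    step : ∀ b' → Reads L' (suc j) (pathArcs (b' ∷ bs')) → BlockStep true b' bs bs' k j
    step false r' = forward≢backward (proj₂ s2) (r' 1)
    step true  r' = record
      { implies = λ _ → tt
      ; next    = record { reads  = Reads-segment L k true bs reads
                         ; reads' = Reads-segment L' (suc j) true bs' r'
                         ; entry' = proj₂ s1 ; W-k = proj₁ s1 }
      ; fixes   = λ { _ zero _ → W-k ; _ (suc _) (s≤s ()) } }

  -- The middle vertex of the zigzag goes either back to the block start (the zigzag is folded
  -- onto a single edge) or forward along a zigzag of L'.
  zigzag-step : ∀ b' bs bs' k j → Aligned (false ∷ bs) (b' ∷ bs') k j → BlockStep false b' bs bs' k j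
  zigzag-step b' bs bs' k j al = step b' reads' (Arc-into-suc back)
    where
    open Aligned al
    s1 = follow-forward W-k (reads 0) entry'
    back : Arc L' (W (2 + k)) (suc (suc j))
    back = subst (Arc L' (W (2 + k))) (proj₁ s1) (W-arc (2 + k) (1 + k) (backward refl (reads 1)))
    step : ∀ b' → Reads L' (suc j) (pathArcs (b' ∷ bs')) →
           (W (2 + k) ≡ suc j × arcAt L' (suc j) ≡ just true) ⊎
           (W (2 + k) ≡ 3 + j × arcAt L' (2 + j) ≡ just false) → BlockStep false b' bs bs' k j
    step b' r' (inj₁ (W2 , _)) = folded b' r'
      where
      s3 = follow-forward W2 (reads 2) entry'
      s4 = follow-forward (proj₁ s3) (trans (reads 3) (pathArcs-head bs)) (proj₂ s3)
      folded : ∀ b' → Reads L' (suc j) (pathArcs (b' ∷ bs')) → BlockStep false b' bs bs' k j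
      folded false r' = forward≢backward (proj₂ s4) (r' 1)
      folded true  r' = record
        { implies = λ ()
        ; next    = record { reads  = Reads-segment L k false bs reads
                           ; reads' = Reads-segment L' (suc j) true bs' r'
                           ; entry' = proj₂ s3 ; W-k = proj₁ s3 }
        ; fixes   = λ () }
    step true  r' (inj₂ (_ , f)) = forward≢backward (trans (r' 1) (pathArcs-head bs')) f
    step false r' (inj₂ (W2 , f)) with Arc-out-of-suc (subst (λ z → Arc L' z (W (3 + k))) W2
                                         (W-arc (2 + k) (3 + k) (forward refl (reads 2))))
    ... | inj₂ (W3 , _) =
      forward≢backward (proj₂ (follow-forward W3 (trans (reads 3) (pathArcs-head bs)) (proj₂ s1))) f
    ... | inj₁ (W3 , t) = record
      { implies = λ ()
      ; next    = record { reads  = Reads-segment L k false bs reads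
                         ; reads' = Reads-segment L' (suc j) false bs' r'
                         ; entry' = t ; W-k = W3 }
      ; fixes   = λ { _ 0 _ → W-k ; _ 1 _ → proj₁ s1 ; _ 2 _ → W2
                    ; _ (suc (suc (suc _))) (s≤s (s≤s (s≤s ()))) } }

  block-step : ∀ b b' bs bs' k j → Aligned (b ∷ bs) (b' ∷ bs') k j → BlockStep b b' bs bs' k j
  block-step true  = single-step
  block-step false = zigzag-step

  walk : ∀ bs bs' k j → List.length bs ≡ List.length bs' → Aligned bs bs' k j →
         bs ⊆ᵇ bs' × (bs ≡ bs' → ∀ i → i ≤ List.length (pathArcs bs) → W (i + k) ≡ i + suc j)
  walk []       []         k j _   al =
    [] , λ { _ 0 _ → W-k ; _ 1 _ → proj₁ (follow-forward W-k (reads 0) entry') ; _ (suc (suc _)) (s≤s ()) }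
    where open Aligned al
  walk (b ∷ bs) (b' ∷ bs') k j len al = implies ∷ proj₁ rest , fixes-all
    where
    open BlockStep (block-step b b' bs bs' k j al)
    rest = walk bs bs' _ _ (ℕP.suc-injective len) next
    fixes-all : b ∷ bs ≡ b' ∷ bs' → ∀ i → i ≤ List.length (pathArcs (b ∷ bs)) → W (i + k) ≡ i + suc j
    fixes-all refl i i≤ =
      ≤-+-cases {λ i → W (i + k) ≡ i + suc j} s (List.length (pathArcs bs)) (fixes refl)
        (λ i i≤ → trans (cong W (+-rearrange s i k))
                    (trans (proj₂ rest refl i i≤)
                      (sym (trans (+-rearrange s i (suc j)) (cong (λ z → i + z) (ℕP.+-suc s j))))))
        i (subst (i ≤_) (length-pathArcs-∷ b bs) i≤)
      where s = List.length (segment b)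

module _ (bs bs' : List Bool) (W : ℕ → ℕ)
         (W-arc : ∀ a b → Arc (true ∷ pathArcs bs) a b → Arc (true ∷ pathArcs bs') (W a) (W b))
         (W-0 : W 0 ≡ 0) (same-length : List.length bs ≡ List.length bs') where

  open Walk (true ∷ pathArcs bs) (true ∷ pathArcs bs') W W-arc

  private
    start : Aligned bs bs' 1 0
    start = record
      { reads  = λ i → cong (arcAt (true ∷ pathArcs bs)) (ℕP.+-comm i 1)
      ; reads' = λ i → cong (arcAt (true ∷ pathArcs bs')) (ℕP.+-comm i 1)
      ; entry' = refl
      ; W-k    = Arc-from-0 (subst (λ z → Arc _ z (W 1)) W-0 (W-arc 0 1 (forward refl refl))) }

  Q-hom-⊆ᵇ : bs ⊆ᵇ bs'
  Q-hom-⊆ᵇ = proj₁ (walk bs bs' 1 0 same-length start)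

  Q-endo-identity : bs ≡ bs' → ∀ p → p ≤ List.length (true ∷ pathArcs bs) → W p ≡ p
  Q-endo-identity e zero    _       = W-0
  Q-endo-identity e (suc p) (s≤s q) =
    trans (cong W (ℕP.+-comm 1 p))
      (trans (proj₂ (walk bs bs' 1 0 same-length start) e p q) (ℕP.+-comm p 1))

module ExtendedDualProperties {n : ℕ} (Γ : Lang (Fin n)) where
  open ExtendedDual Γ

  Tuple : Set
  Tuple = Vec (Fin n) m

  Copy : Set
  Copy = Fin n × Tuple

  flag : Fin n → Fin n → Bool
  flag d c = ⌊ c F.≟ d ⌋

  flags : Fin n → Tuple → List Bool
  flags d x = List.map (flag d) (Vec.toList x)

  tailArcs : Fin n → Tuple → List Bool
  tailArcs d x = List.concatMap (block d) (Vec.toList x) List.++ true ∷ []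

  tailArcs≡pathArcs : ∀ d x → tailArcs d x ≡ pathArcs (flags d x)
  tailArcs≡pathArcs d x =
    cong (List._++ true ∷ []) (sym (ListP.concatMap-map segment (flag d) (Vec.toList x)))

  arcs≡Q : ∀ d x → arcs d x ≡ true ∷ pathArcs (flags d x)
  arcs≡Q d x = cong (true ∷_) (tailArcs≡pathArcs d x)

  length-flags : ∀ d x → List.length (flags d x) ≡ m
  length-flags d x = trans (ListP.length-map (flag d) (Vec.toList x)) (VecP.length-toList x)

  len≡ : ∀ d x → len d x ≡ List.length (true ∷ pathArcs (flags d x))
  len≡ d x = cong List.length (arcs≡Q d x)

  1<len : ∀ d x → 1 < len d x
  1<len d x = subst (1 <_) (sym (len≡ d x)) (s≤s (pathArcs-≢[] (flags d x)))

  D'-≡ : ∀ {y z : Tuple} (fy : Feas φΓ y) (fz : Feas φΓ z) → y ≡ z → _≡_ {A = D'} (y , fy) (z , fz)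
  D'-≡ fy fz refl = cong (_ ,_) (T-irrelevant fy fz)

  Internal : V → Set
  Internal (vE _ _ _) = ⊤
  Internal _          = ⊥

  posIn-start : ∀ d x → posIn d x (vD d) ≡ just 0
  posIn-start d x rewrite isYes-complete (d F.≟ d) refl = refl

  posIn-end : ∀ d (x̂ : D') → posIn d (proj₁ x̂) (vD' x̂) ≡ just (len d (proj₁ x̂))
  posIn-end d (x , _) rewrite isYes-complete (VecP.≡-dec F._≟_ x x) refl = refl

  posIn-inner : ∀ d (x̂ : D') k → posIn d (proj₁ x̂) (vE d x̂ k) ≡ just (suc (F.toℕ k))
  posIn-inner d (x , _) k
    rewrite isYes-complete (d F.≟ d) refl | isYes-complete (VecP.≡-dec F._≟_ x x) refl = refl

  posIn-vD⁻ : ∀ d x d' a → posIn d x (vD d') ≡ just a → d' ≡ d × a ≡ 0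
  posIn-vD⁻ d x d' a e with d' F.≟ d
  ... | yes d'≡d = d'≡d , sym (just-injective e)
  ... | no _ with () ← e

  posIn-vD'⁻ : ∀ d x y fy a → posIn d x (vD' (y , fy)) ≡ just a → y ≡ x × a ≡ len d x
  posIn-vD'⁻ d x y fy a e with VecP.≡-dec F._≟_ y x
  ... | yes y≡x = y≡x , sym (just-injective e)
  ... | no _ with () ← e

  posIn-vE⁻ : ∀ d x d' y fy k a → posIn d x (vE d' (y , fy) k) ≡ just a →
              d' ≡ d × y ≡ x × a ≡ suc (F.toℕ k)
  posIn-vE⁻ d x d' y fy k a e with d' F.≟ d | VecP.≡-dec F._≟_ y x
  ... | yes d'≡d | yes y≡x = d'≡d , y≡x , sym (just-injective e)
  ... | yes _    | no _ with () ← e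
  ... | no _     | _    with () ← e

  end≢inner : ∀ d x y fy d' z fz k p →
              posIn d x (vD' (y , fy)) ≡ just p → posIn d x (vE d' (z , fz) k) ≡ just p → ⊥
  end≢inner d x y fy d' z fz k p e₁ e₂ with refl , refl , r ← posIn-vE⁻ d x d' z fz k p e₂ =
    ℕP.<-irrefl (ℕP.suc-injective (trans (sym r) (proj₂ (posIn-vD'⁻ d x y fy p e₁)))) (FP.toℕ<n k)

  posIn-injective : ∀ d x u v p → posIn d x u ≡ just p → posIn d x v ≡ just p → u ≡ v
  posIn-injective d x (vD d₁) (vD d₂) p e₁ e₂ =
    cong vD (trans (proj₁ (posIn-vD⁻ d x d₁ p e₁)) (sym (proj₁ (posIn-vD⁻ d x d₂ p e₂))))
  posIn-injective d x (vD d₁) (vD' (y , fy)) p e₁ e₂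
    with refl ← proj₂ (posIn-vD⁻ d x d₁ p e₁) | () ← proj₂ (posIn-vD'⁻ d x y fy p e₂)
  posIn-injective d x (vD d₁) (vE d₂ (y , fy) k) p e₁ e₂
    with refl ← proj₂ (posIn-vD⁻ d x d₁ p e₁) | () ← proj₂ (proj₂ (posIn-vE⁻ d x d₂ y fy k p e₂))
  posIn-injective d x (vD' (y , fy)) (vD d₁) p e₁ e₂
    with refl ← proj₂ (posIn-vD⁻ d x d₁ p e₂) | () ← proj₂ (posIn-vD'⁻ d x y fy p e₁)
  posIn-injective d x (vE d₂ (y , fy) k) (vD d₁) p e₁ e₂
    with refl ← proj₂ (posIn-vD⁻ d x d₁ p e₂) | () ← proj₂ (proj₂ (posIn-vE⁻ d x d₂ y fy k p e₁))
  posIn-injective d x (vD' (y , fy)) (vD' (z , fz)) p e₁ e₂ =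
    cong vD' (D'-≡ fy fz (trans (proj₁ (posIn-vD'⁻ d x y fy p e₁))
                                (sym (proj₁ (posIn-vD'⁻ d x z fz p e₂)))))
  posIn-injective d x (vD' (y , fy)) (vE d₂ (z , fz) k) p e₁ e₂ = ⊥-elim (end≢inner d x y fy d₂ z fz k p e₁ e₂)
  posIn-injective d x (vE d₂ (z , fz) k) (vD' (y , fy)) p e₁ e₂ = ⊥-elim (end≢inner d x y fy d₂ z fz k p e₂ e₁)
  posIn-injective d x (vE d₁ (y , fy) k₁) (vE d₂ (z , fz) k₂) p e₁ e₂
    with refl , refl , r₁ ← posIn-vE⁻ d x d₁ y fy k₁ p e₁
       | refl , refl , r₂ ← posIn-vE⁻ d x d₂ z fz k₂ p e₂
    with refl ← T-irrelevant fy fz =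
    cong (vE d (x , fy)) (FP.toℕ-injective (ℕP.suc-injective (trans (sym r₁) r₂)))

  isDir≡true : ∀ mb b → isDir mb b ≡ true → mb ≡ just b
  isDir≡true (just true)  true  _ = refl
  isDir≡true (just false) false _ = refl

  arcTest : List Bool → ℕ → ℕ → Bool
  arcTest L a b = (⌊ b ℕ.≟ suc a ⌋ ∧ isDir (arcAt L a) true) ∨ (⌊ a ℕ.≟ suc b ⌋ ∧ isDir (arcAt L b) false)

  arcTest-sound : ∀ L a b → arcTest L a b ≡ true → Arc L a b
  arcTest-sound L a b e with ∨≡true⇒⊎ _ _ e
  ... | inj₁ e₁ = let (p , q) = ∧≡true⇒× _ _ e₁ in forward  (isYes-sound (b ℕ.≟ suc a) p) (isDir≡true _ _ q)
  ... | inj₂ e₂ = let (p , q) = ∧≡true⇒× _ _ e₂ in backward (isYes-sound (a ℕ.≟ suc b) p) (isDir≡true _ _ q)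

  arcTest-complete : ∀ L a b → Arc L a b → arcTest L a b ≡ true
  arcTest-complete L a .(suc a) (forward refl t) rewrite isYes-complete (suc a ℕ.≟ suc a) refl | t = refl
  arcTest-complete L .(suc b) b (backward refl f) rewrite isYes-complete (suc b ℕ.≟ suc b) refl | f = ∨-zeroʳ _

  record EdgeOnCopy (u v : V) : Set where
    field
      copy     : Copy
      pos-u    : ℕ
      pos-v    : ℕ
      at-u     : posIn (proj₁ copy) (proj₂ copy) u ≡ just pos-u
      at-v     : posIn (proj₁ copy) (proj₂ copy) v ≡ just pos-v
      arc      : Arc (arcs (proj₁ copy) (proj₂ copy)) pos-u pos-v
      internal : Internal u ⊎ Internal v

  edgeIn-elim : ∀ d x u v → Internal u ⊎ Internal v → edgeIn d x u v ≡ true → EdgeOnCopy u v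
  edgeIn-elim d x u v i e with posIn d x u in eu | posIn d x v in ev
  ... | just a  | just b  = record { copy = d , x ; at-u = eu ; at-v = ev
                                   ; arc = arcTest-sound (arcs d x) a b e ; internal = i }
  ... | just _  | nothing with () ← e
  ... | nothing | _       with () ← e

  edge-elim : ∀ u v → edge u v ≡ true → EdgeOnCopy u v
  edge-elim (vE d x k) v            = edgeIn-elim d (proj₁ x) _ v (inj₁ tt)
  edge-elim (vD a)     (vE d x k)   = edgeIn-elim d (proj₁ x) _ _ (inj₂ tt)
  edge-elim (vD' y)    (vE d x k)   = edgeIn-elim d (proj₁ x) _ _ (inj₂ tt)
  edge-elim (vD _)     (vD _)       ()
  edge-elim (vD _)     (vD' _)      ()
  edge-elim (vD' _)    (vD _)       ()
  edge-elim (vD' _)    (vD' _)      ()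

  edgeIn-intro : ∀ d x u v a b → posIn d x u ≡ just a → posIn d x v ≡ just b →
                 Arc (arcs d x) a b → edgeIn d x u v ≡ true
  edgeIn-intro d x u v a b eu ev ab with posIn d x u | posIn d x v | eu | ev
  ... | _ | _ | refl | refl = arcTest-complete (arcs d x) a b ab

  edge-intro : ∀ d x u v a b → posIn d x u ≡ just a → posIn d x v ≡ just b →
               Arc (arcs d x) a b → Internal u ⊎ Internal v → edge u v ≡ true
  edge-intro d x u@(vE d' (y , fy) k) v a b eu ev ab _
    with refl , refl , _ ← posIn-vE⁻ d x d' y fy k a eu = edgeIn-intro d x u v a b eu ev ab
  edge-intro d x u@(vD _) v@(vE d' (y , fy) k) a b eu ev ab _
    with refl , refl , _ ← posIn-vE⁻ d x d' y fy k b ev = edgeIn-intro d x u v a b eu ev ab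
  edge-intro d x u@(vD' _) v@(vE d' (y , fy) k) a b eu ev ab _
    with refl , refl , _ ← posIn-vE⁻ d x d' y fy k b ev = edgeIn-intro d x u v a b eu ev ab
  edge-intro d x (vD _)  (vD _)  _ _ _ _ _ i = ⊥-elim ([ (λ ()) , (λ ()) ]′ i)
  edge-intro d x (vD _)  (vD' _) _ _ _ _ _ i = ⊥-elim ([ (λ ()) , (λ ()) ]′ i)
  edge-intro d x (vD' _) (vD _)  _ _ _ _ _ i = ⊥-elim ([ (λ ()) , (λ ()) ]′ i)
  edge-intro d x (vD' _) (vD' _) _ _ _ _ _ i = ⊥-elim ([ (λ ()) , (λ ()) ]′ i)

  lev : V → ℕ
  lev (vD _)     = 0
  lev (vD' _)    = 2 + m
  lev (vE d x k) = height 0 (arcs d (proj₁ x)) (suc (F.toℕ k))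

  height-arcs-end : ∀ d x → height 0 (arcs d x) (len d x) ≡ 2 + m
  height-arcs-end d x =
    subst (λ L → height 0 L (List.length L) ≡ 2 + m) (sym (arcs≡Q d x))
      (trans (height-end (flags d x) 1) (trans (cong (_+ 2) (length-flags d x)) (ℕP.+-comm m 2)))

  height-arcs-arc : ∀ d x a b → Arc (arcs d x) a b → height 0 (arcs d x) b ≡ suc (height 0 (arcs d x) a)
  height-arcs-arc d x a b =
    subst (λ L → Arc L a b → height 0 L b ≡ suc (height 0 L a)) (sym (arcs≡Q d x)) (height-arc-Q (flags d x) a b)

  lev-posIn : ∀ d x u a → posIn d x u ≡ just a → lev u ≡ height 0 (arcs d x) a
  lev-posIn d x (vD d') a e with _ , refl ← posIn-vD⁻ d x d' a e = refl
  lev-posIn d x (vD' (y , fy)) a e with refl , refl ← posIn-vD'⁻ d x y fy a e = sym (height-arcs-end d x)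
  lev-posIn d x (vE d' (y , fy) k) a e with refl , refl , refl ← posIn-vE⁻ d x d' y fy k a e = refl

  lev-edge : ∀ u v → edge u v ≡ true → lev v ≡ suc (lev u)
  lev-edge u v e =
    trans (lev-posIn d x v _ at-v) (trans (height-arcs-arc d x _ _ arc) (cong suc (sym (lev-posIn d x u _ at-u))))
    where
    open EdgeOnCopy (edge-elim u v e)
    d = proj₁ copy
    x = proj₂ copy

  lev-inner : ∀ d x̂ k → 1 ≤ lev (vE d x̂ k) × lev (vE d x̂ k) ≤ suc m
  lev-inner d (x , _) k =
    subst (λ L → 1 ≤ height 0 L (suc (F.toℕ k)) × height 0 L (suc (F.toℕ k)) ≤ suc m) (sym (arcs≡Q d x))
      (height-≥ (flags d x) 1 (F.toℕ k) ,
       subst (height 1 (pathArcs (flags d x)) (F.toℕ k) ≤_)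
         (trans (cong (_+ 1) (length-flags d x)) (ℕP.+-comm m 1))
         (height-< (flags d x) 1 (F.toℕ k) (subst (F.toℕ k <_) (ℕP.suc-injective (len≡ d x)) (FP.toℕ<n k))))

  lev-≤ : ∀ v → lev v ≤ 2 + m
  lev-≤ (vD _)     = z≤n
  lev-≤ (vD' _)    = ℕP.≤-refl
  lev-≤ (vE d x k) = ℕP.m≤n⇒m≤1+n (proj₂ (lev-inner d x k))

  lev≡0⇒vD : ∀ v → lev v ≡ 0 → Σ (Fin n) (λ d → v ≡ vD d)
  lev≡0⇒vD (vD d)     _ = d , refl
  lev≡0⇒vD (vE d x k) e with () ← subst (1 ≤_) e (proj₁ (lev-inner d x k))

  lev≡top⇒vD' : ∀ v → lev v ≡ 2 + m → Σ D' (λ y → v ≡ vD' y)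
  lev≡top⇒vD' (vD' y)    _ = y , refl
  lev≡top⇒vD' (vE d x k) e = ⊥-elim (ℕP.1+n≰n (subst (_≤ suc m) e (proj₂ (lev-inner d x k))))

  lev-middle⇒Internal : ∀ v → 1 ≤ lev v × lev v ≤ suc m → Internal v
  lev-middle⇒Internal (vD' _)    (_ , h) = ⊥-elim (ℕP.1+n≰n h)
  lev-middle⇒Internal (vE _ _ _) _       = tt

  Internal⇒lev-middle : ∀ v → Internal v → 1 ≤ lev v × lev v ≤ suc m
  Internal⇒lev-middle (vE d x̂ k) _ = lev-inner d x̂ k

  vertexAt : Fin n → D' → ℕ → V
  vertexAt a x̂ zero = vD a
  vertexAt a x̂ (suc q) with q ℕ.<? len a (proj₁ x̂) ℕ.∸ 1
  ... | yes q< = vE a x̂ (F.fromℕ< q<)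
  ... | no  _  = vD' x̂

  posIn-vertexAt : ∀ a x̂ p → p ≤ len a (proj₁ x̂) → posIn a (proj₁ x̂) (vertexAt a x̂ p) ≡ just p
  posIn-vertexAt a x̂ zero    _       = posIn-start a (proj₁ x̂)
  posIn-vertexAt a x̂ (suc q) (s≤s h) with q ℕ.<? len a (proj₁ x̂) ℕ.∸ 1
  ... | yes q< = trans (posIn-inner a x̂ _) (cong (just ∘ suc) (FP.toℕ-fromℕ< q<))
  ... | no ¬q< = trans (posIn-end a x̂) (cong (just ∘ suc) (ℕP.≤-antisym (ℕP.≮⇒≥ ¬q<) h))

  vertexAt-end : ∀ a x̂ → vertexAt a x̂ (len a (proj₁ x̂)) ≡ vD' x̂
  vertexAt-end a x̂ = posIn-injective a (proj₁ x̂) _ _ _ (posIn-vertexAt a x̂ _ ℕP.≤-refl) (posIn-end a x̂)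

  vertexAt-internal : ∀ a x̂ p → 1 ≤ p → p < len a (proj₁ x̂) → Internal (vertexAt a x̂ p)
  vertexAt-internal a x̂ (suc q) _ (s≤s h) with q ℕ.<? len a (proj₁ x̂) ℕ.∸ 1
  ... | yes _  = tt
  ... | no ¬q< = ⊥-elim (¬q< h)

  vertexAt-adjacent-internal : ∀ a x̂ p → suc p ≤ len a (proj₁ x̂) →
                               Internal (vertexAt a x̂ p) ⊎ Internal (vertexAt a x̂ (suc p))
  vertexAt-adjacent-internal a x̂ zero    _ = inj₂ (vertexAt-internal a x̂ 1 (s≤s z≤n) (1<len a (proj₁ x̂)))
  vertexAt-adjacent-internal a x̂ (suc p) h = inj₁ (vertexAt-internal a x̂ (suc p) (s≤s z≤n) h)

  Arc⇒edge : ∀ a x̂ p q → Arc (arcs a (proj₁ x̂)) p q → edge (vertexAt a x̂ p) (vertexAt a x̂ q) ≡ true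
  Arc⇒edge a x̂ p .(suc p) pq@(forward refl t) =
    let p< = arcAt-< (arcs a (proj₁ x̂)) p t in
    edge-intro a (proj₁ x̂) _ _ p (suc p) (posIn-vertexAt a x̂ p (ℕP.<⇒≤ p<)) (posIn-vertexAt a x̂ (suc p) p<)
      pq (vertexAt-adjacent-internal a x̂ p p<)
  Arc⇒edge a x̂ .(suc q) q qp@(backward refl f) =
    let q< = arcAt-< (arcs a (proj₁ x̂)) q f in
    edge-intro a (proj₁ x̂) _ _ (suc q) q (posIn-vertexAt a x̂ (suc q) q<) (posIn-vertexAt a x̂ q (ℕP.<⇒≤ q<))
      qp (Sum.swap (vertexAt-adjacent-internal a x̂ q q<))

  𝔻Γ-edge : ∀ u v → edge u v ≡ true → 𝔻Γ (u ∷ v ∷ []) ≡ fin 0ℚ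
  𝔻Γ-edge u v e rewrite e = refl

  edge-feasible : ∀ u v → Feas 𝔻Γ (u ∷ v ∷ []) → edge u v ≡ true
  edge-feasible u v f with edge u v
  ... | true = refl

  feasible-edge : ∀ u v → edge u v ≡ true → Feas 𝔻Γ (u ∷ v ∷ [])
  feasible-edge u v e rewrite e = tt

  -- Lifting a map on D to 𝔻_Γ

  flags-⊆ᵇ : ∀ (g : Fin n → Fin n) d x → flags d x ⊆ᵇ flags (g d) (Vec.map g x)
  flags-⊆ᵇ g d x rewrite VecP.toList-map g x = go (Vec.toList x)
    where
    go : ∀ cs → List.map (flag d) cs ⊆ᵇ List.map (flag (g d)) (List.map g cs)
    go []       = []
    go (c ∷ cs) = (λ c≡d → fromWitness (cong g (toWitness c≡d))) ∷ go cs

  tailHom : ∀ g d x → Hom (tailArcs d x) (tailArcs (g d) (Vec.map g x))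
  tailHom g d x =
    subst₂ Hom (sym (tailArcs≡pathArcs d x)) (sym (tailArcs≡pathArcs (g d) (Vec.map g x)))
      (Hom-⊆ᵇ (flags-⊆ᵇ g d x))

  arcsHom : ∀ g d x → Hom (arcs d x) (arcs (g d) (Vec.map g x))
  arcsHom g d x = Hom-∷ true (tailHom g d x)

  -- The copy from d to x is mapped onto the copy from g d to g x; where g x ∉ D′ (g not a
  -- polymorphism) the value is irrelevant and the vertex is left in place.
  lift : (Fin n → Fin n) → V → V
  lift g (vD a) = vD (g a)
  lift g (vD' (x , fx)) with T? (isFin (φΓ (Vec.map g x)))
  ... | yes gx = vD' (Vec.map g x , gx)
  ... | no  _  = vD' (x , fx)
  lift g (vE d (x , fx) k) with T? (isFin (φΓ (Vec.map g x)))
  ... | yes gx = vE (g d) (Vec.map g x , gx) (F.fromℕ< (Hom.map-< (tailHom g d x) (F.toℕ k) (FP.toℕ<n k)))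
  ... | no  _  = vE d (x , fx) k

  liftOp : Op (Fin n) 1 → Op V 1
  liftOp g (v ∷ []) = lift (fun₁ g) v

  module _ (g : Fin n → Fin n) (g-pres : PreservesCombined Γ g) where

    lift-vD' : ∀ x fx → lift g (vD' (x , fx)) ≡ vD' (Vec.map g x , g-pres x fx)
    lift-vD' x fx with T? (isFin (φΓ (Vec.map g x)))
    ... | yes gx = cong (λ p → vD' (Vec.map g x , p)) (T-irrelevant gx (g-pres x fx))
    ... | no ¬gx = ⊥-elim (¬gx (g-pres x fx))

    lift-vE : ∀ d x fx k → lift g (vE d (x , fx) k) ≡
      vE (g d) (Vec.map g x , g-pres x fx) (F.fromℕ< (Hom.map-< (tailHom g d x) (F.toℕ k) (FP.toℕ<n k)))
    lift-vE d x fx k with T? (isFin (φΓ (Vec.map g x)))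
    ... | yes gx = cong (λ p → vE (g d) (Vec.map g x , p) _) (T-irrelevant gx (g-pres x fx))
    ... | no ¬gx = ⊥-elim (¬gx (g-pres x fx))

    posIn-lift : ∀ d x u a → posIn d x u ≡ just a →
                 posIn (g d) (Vec.map g x) (lift g u) ≡ just (Hom.map (arcsHom g d x) a)
    posIn-lift d x (vD d') a e with refl , refl ← posIn-vD⁻ d x d' a e = posIn-start (g d) (Vec.map g x)
    posIn-lift d x (vD' (y , fy)) a e with refl , refl ← posIn-vD'⁻ d x y fy a e
      rewrite lift-vD' x fy =
      trans (posIn-end (g d) (Vec.map g x , g-pres x fy))
            (cong (just ∘ suc) (sym (Hom.map-end (tailHom g d x))))
    posIn-lift d x (vE d' (y , fy) k) a e with refl , refl , refl ← posIn-vE⁻ d x d' y fy k a e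
      rewrite lift-vE d x fy k =
      trans (posIn-inner (g d) (Vec.map g x , g-pres x fy) _) (cong (just ∘ suc) (FP.toℕ-fromℕ< _))

    lift-Internal : ∀ v → Internal v → Internal (lift g v)
    lift-Internal (vE d (x , fx) k) _ rewrite lift-vE d x fx k = tt

    lift-edge : ∀ u v → edge u v ≡ true → edge (lift g u) (lift g v) ≡ true
    lift-edge u v e =
      edge-intro (g d) (Vec.map g x) (lift g u) (lift g v) _ _
        (posIn-lift d x u _ at-u) (posIn-lift d x v _ at-v) (Hom.map-arc (arcsHom g d x) _ _ arc) (Sum.map (lift-Internal u) (lift-Internal v) internal)
      where
      open EdgeOnCopy (edge-elim u v e)
      d = proj₁ copy
      x = proj₂ copy

    μΓ-lift-inner : ∀ d x fx k → μΓ (lift g (vE d (x , fx) k) ∷ []) ≡ fin 0ℚ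
    μΓ-lift-inner d x fx k rewrite lift-vE d x fx k = refl

    μΓ-lift-end : ∀ x fx → μΓ (lift g (vD' (x , fx)) ∷ []) ≡ φΓ (Vec.map g x)
    μΓ-lift-end x fx rewrite lift-vD' x fx = refl

  liftOp-pol : ∀ g → IsPol Γ g → IsPol Γe (liftOp g)
  liftOp-pol g g-pol = 𝔻-pol ∷ μ-pol ∷ []
    where
    g-pres = pol⇒preservesCombined Γ g g-pol
    𝔻-pol : IsPolOf (liftOp g) 𝔻Γ
    𝔻-pol ((u ∷ v ∷ []) ∷ []) (f VAll.∷ VAll.[]) =
      feasible-edge (lift (fun₁ g) u) (lift (fun₁ g) v)
        (lift-edge (fun₁ g) g-pres u v (edge-feasible u v f))
    μ-pol : IsPolOf (liftOp g) μΓ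
    μ-pol ((vD _ ∷ []) ∷ [])            _ = tt
    μ-pol ((vE d (x , fx) k ∷ []) ∷ []) _ rewrite lift-vE (fun₁ g) g-pres d x fx k = tt
    μ-pol ((vD' (x , fx) ∷ []) ∷ [])    _ rewrite lift-vD' (fun₁ g) g-pres x fx = g-pres x fx

  liftFracPol : FracPol Γ 1 → FracPol Γe 1
  liftFracPol ω = record
    { dist  = mapOps liftOp (dist ω)
    ; pol   = AllP.map⁺ (All.map (liftOp-pol _) (pol ω))
    ; pos   = AllP.map⁺ (pos ω)
    ; total = trans (cong sumℚ (weights-mapOps liftOp (dist ω))) (total ω)
    ; ineq  = 𝔻-ineq ∷ μ-ineq ∷ [] }
    where
    pres : ∀ g → IsPol Γ g → PreservesCombined Γ (fun₁ g)
    pres = pol⇒preservesCombined Γ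

    ineq-both-zero : ∀ {k} (ψ : CostFun V k) x → ψ x ≡ fin 0ℚ →
      All (λ e → ψ (apply (proj₁ e) (x ∷ [])) ≡ fin 0ℚ) (mapOps liftOp (dist ω)) →
      expect (mapOps liftOp (dist ω)) ψ (x ∷ []) ≤∞ (1ℤ ℚ./ 1) ·∞ sum∞ (ψ x ∷ [])
    ineq-both-zero ψ x ψx≡0 zeros =
      ≤∞-reflexive (trans (expect-zero _ ψ (x ∷ []) zeros) (sym (trans (average-singleton (ψ x)) ψx≡0)))

    𝔻-ineq : UnaryIneq (mapOps liftOp (dist ω)) 𝔻Γ
    𝔻-ineq ((u ∷ v ∷ []) ∷ []) (f VAll.∷ VAll.[]) =
      ineq-both-zero 𝔻Γ (u ∷ v ∷ []) (𝔻Γ-edge u v uv)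
        (AllP.map⁺ (All.map (λ {e} g-pol → let g = fun₁ (proj₁ e) in
          𝔻Γ-edge (lift g u) (lift g v) (lift-edge g (pres (proj₁ e) g-pol) u v uv)) (pol ω)))
      where uv = edge-feasible u v f

    μ-ineq : UnaryIneq (mapOps liftOp (dist ω)) μΓ
    μ-ineq ((vD a ∷ []) ∷ []) _ =
      ineq-both-zero μΓ (vD a ∷ []) refl (AllP.map⁺ (All.universal (λ _ → refl) (dist ω)))
    μ-ineq ((vE d (x , fx) k ∷ []) ∷ []) _ =
      ineq-both-zero μΓ (vE d (x , fx) k ∷ []) refl
        (AllP.map⁺ (All.map (λ {e} g-pol → μΓ-lift-inner (fun₁ (proj₁ e)) (pres (proj₁ e) g-pol) d x fx k)
                            (pol ω)))
    μ-ineq ((vD' (x , fx) ∷ []) ∷ []) _ =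
      subst (expect (mapOps liftOp (dist ω)) μΓ ((vD' (x , fx) ∷ []) ∷ []) ≤∞_)
        (sym (average-singleton (φΓ x)))
        (subst (_≤∞ φΓ x)
          (sym (expect-mapOps liftOp (dist ω) μΓ _ φΓ (x ∷ [])
            (All.map (λ {e} g-pol → trans (μΓ-lift-end (fun₁ (proj₁ e)) (pres (proj₁ e) g-pol) x fx)
                                            (cong φΓ (sym (apply-unary (proj₁ e) x))))
              (pol ω))))
          (unaryIneqs⇒combinedIneq Γ (dist ω) (ineq ω) x fx))

  vD-injective : ∀ {a b} → vD a ≡ vD b → a ≡ b
  vD-injective refl = refl

  rigidCore-Γe⇒Γ : RigidCore Γe → RigidCore Γ
  rigidCore-Γe⇒Γ rigid f (ω , f∈ω) a =
    let (g , _ , g≗f , liftg∈ω) = Any-mapOps liftOp (dist ω) (pol ω) f∈ω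
    in trans (sym (g≗f (a ∷ []))) (vD-injective (rigid (liftOp g) (liftFracPol ω , liftg∈ω) (vD a)))

  OnCopy : Copy → V → Set
  OnCopy (d , x) w = Σ ℕ (λ q → posIn d x w ≡ just q)

  copyOf : V → Maybe Copy
  copyOf (vE d x _) = just (d , proj₁ x)
  copyOf _          = nothing

  OnCopy⇒copyOf : ∀ c w → Internal w → OnCopy c w → copyOf w ≡ just c
  OnCopy⇒copyOf (d , x) (vE d' (y , fy) k) _ (q , e) with refl , refl , _ ← posIn-vE⁻ d x d' y fy k q e = refl

  copyOf⇒OnCopy : ∀ c w → copyOf w ≡ just c → OnCopy c w
  copyOf⇒OnCopy c (vE d (y , fy) k) e with refl ← just-injective e = suc (F.toℕ k) , posIn-inner d (y , fy) k

  OnCopy-vD : ∀ c d → OnCopy c (vD d) → d ≡ proj₁ c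
  OnCopy-vD c d (q , e) = proj₁ (posIn-vD⁻ (proj₁ c) (proj₂ c) d q e)

  OnCopy-vD' : ∀ c ŷ → OnCopy c (vD' ŷ) → proj₁ ŷ ≡ proj₂ c
  OnCopy-vD' c ŷ (q , e) = proj₁ (posIn-vD'⁻ (proj₁ c) (proj₂ c) (proj₁ ŷ) (proj₂ ŷ) q e)

  Adjacent : V → V → Set
  Adjacent u v = edge u v ≡ true ⊎ edge v u ≡ true

  Adjacent-copy : ∀ u v → Adjacent u v → Σ Copy (λ c → OnCopy c u × OnCopy c v)
  Adjacent-copy u v (inj₁ e) = let open EdgeOnCopy (edge-elim u v e) in copy , (pos-u , at-u) , (pos-v , at-v)
  Adjacent-copy u v (inj₂ e) = let open EdgeOnCopy (edge-elim v u e) in copy , (pos-v , at-v) , (pos-u , at-u)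

  vertexAt-Adjacent : ∀ a x̂ p → suc p ≤ len a (proj₁ x̂) → Adjacent (vertexAt a x̂ p) (vertexAt a x̂ (suc p))
  vertexAt-Adjacent a x̂ p h with arcAt-just (arcs a (proj₁ x̂)) p h
  ... | true  , t = inj₁ (Arc⇒edge a x̂ p (suc p) (forward refl t))
  ... | false , f = inj₂ (Arc⇒edge a x̂ (suc p) p (backward refl f))

  ⊆ᵇ-lookup : ∀ {k} (x y : Vec (Fin n) k) a d →
              List.map (flag a) (Vec.toList x) ⊆ᵇ List.map (flag d) (Vec.toList y) →
              ∀ i → lookup x i ≡ a → lookup y i ≡ d
  ⊆ᵇ-lookup (_ ∷ _) (_ ∷ _) a d (t ∷ _) F.zero    e = toWitness (t (fromWitness e))
  ⊆ᵇ-lookup (_ ∷ x) (_ ∷ y) a d (_ ∷ s) (F.suc i) e = ⊆ᵇ-lookup x y a d s i e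

  toD : Fin n → V → Fin n
  toD _ (vD d) = d
  toD a _      = a

  -- For an endomorphism the fallback a of toD is never used (see H-vD-restrict).
  restrictD : (V → V) → Fin n → Fin n
  restrictD H a = toD a (H (vD a))

  IsEndo : (V → V) → Set
  IsEndo H = ∀ u v → edge u v ≡ true → edge (H u) (H v) ≡ true

  module Endomorphism (H : V → V) (H-edge : IsEndo H) where

    H-Adjacent : ∀ {u v} → Adjacent u v → Adjacent (H u) (H v)
    H-Adjacent {u} {v} = Sum.map (H-edge u v) (H-edge v u)

    lev-H-edge : ∀ c u v → edge u v ≡ true → lev (H u) ≡ c + lev u → lev (H v) ≡ c + lev v
    lev-H-edge c u v e h =
      trans (lev-edge (H u) (H v) (H-edge u v e))
        (trans (cong suc h) (trans (sym (ℕP.+-suc c (lev u))) (cong (c +_) (sym (lev-edge u v e)))))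

    lev-H-edge⁻ : ∀ c u v → edge u v ≡ true → lev (H v) ≡ c + lev v → lev (H u) ≡ c + lev u
    lev-H-edge⁻ c u v e h =
      ℕP.suc-injective (trans (sym (lev-edge (H u) (H v) (H-edge u v e)))
        (trans h (trans (cong (c +_) (lev-edge u v e)) (ℕP.+-suc c (lev u)))))

    lev-H-vertexAt : ∀ a x̂ p → p ≤ len a (proj₁ x̂) →
                     lev (H (vertexAt a x̂ p)) ≡ lev (H (vD a)) + lev (vertexAt a x̂ p)
    lev-H-vertexAt a x̂ zero    _ = sym (ℕP.+-identityʳ _)
    lev-H-vertexAt a x̂ (suc p) h with vertexAt-Adjacent a x̂ p h
    ... | inj₁ e = lev-H-edge  _ _ _ e (lev-H-vertexAt a x̂ p (ℕP.<⇒≤ h))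
    ... | inj₂ e = lev-H-edge⁻ _ _ _ e (lev-H-vertexAt a x̂ p (ℕP.<⇒≤ h))

    lev-H-vD' : ∀ a x̂ → lev (H (vD' x̂)) ≡ lev (H (vD a)) + (2 + m)
    lev-H-vD' a x̂ = subst (λ w → lev (H w) ≡ lev (H (vD a)) + lev w) (vertexAt-end a x̂)
                      (lev-H-vertexAt a x̂ _ ℕP.≤-refl)

    lev-H-vD : D' → ∀ a → lev (H (vD a)) ≡ 0
    lev-H-vD x̂ a = ℕP.n≤0⇒n≡0 (ℕP.+-cancelʳ-≤ (2 + m) _ 0
                     (subst (_≤ 2 + m) (lev-H-vD' a x̂) (lev-≤ (H (vD' x̂)))))

    H-vD : D' → ∀ a → Σ (Fin n) (λ d → H (vD a) ≡ vD d)
    H-vD x̂ a = lev≡0⇒vD _ (lev-H-vD x̂ a)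

    H-vD'-via : Fin n → ∀ x̂ → Σ D' (λ ŷ → H (vD' x̂) ≡ vD' ŷ)
    H-vD'-via a x̂ = lev≡top⇒vD' _ (trans (lev-H-vD' a x̂) (cong (_+ (2 + m)) (lev-H-vD x̂ a)))

    -- H-vD'-via needs some element of D; if H (vD' x̂) ∉ D′, that vertex itself supplies one.
    H-vD' : ∀ x̂ → Σ D' (λ ŷ → H (vD' x̂) ≡ vD' ŷ)
    H-vD' x̂ with H (vD' x̂) in e
    ... | vD' ŷ    = ŷ , refl
    ... | vD d     with () ← trans (sym e) (proj₂ (H-vD'-via d x̂))
    ... | vE d _ _ with () ← trans (sym e) (proj₂ (H-vD'-via d x̂))

    H-internal : ∀ a x̂ p → 1 ≤ p → p < len a (proj₁ x̂) → Internal (H (vertexAt a x̂ p))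
    H-internal a x̂ p 1≤p p<len =
      lev-middle⇒Internal _ (subst (λ l → 1 ≤ l × l ≤ suc m) (sym same-lev)
        (Internal⇒lev-middle _ (vertexAt-internal a x̂ p 1≤p p<len)))
      where
      same-lev : lev (H (vertexAt a x̂ p)) ≡ lev (vertexAt a x̂ p)
      same-lev = trans (lev-H-vertexAt a x̂ p (ℕP.<⇒≤ p<len)) (cong (_+ _) (lev-H-vD x̂ a))

    -- The copy from a to x̂ is mapped onto the copy from d to ŷ: its internal vertices go to
    -- internal vertices, consecutive ones share their copy, and the ends pin that copy down.
    module ImageCopy (a : Fin n) (x̂ : D') (d : Fin n) (ŷ : D')
                     (H-a : H (vD a) ≡ vD d) (H-x̂ : H (vD' x̂) ≡ vD' ŷ) where
      x = proj₁ x̂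
      y = proj₁ ŷ

      image : ℕ → V
      image p = H (vertexAt a x̂ p)

      last : ℕ
      last = len a x ℕ.∸ 1

      1≤last : 1 ≤ last
      1≤last = ℕP.≤-pred (1<len a x)

      image-internal : ∀ p → 1 ≤ p → p < len a x → Internal (image p)
      image-internal = H-internal a x̂

      image-neighbours : ∀ p → suc p ≤ len a x →
                         Σ Copy (λ c → OnCopy c (image p) × OnCopy c (image (suc p)))
      image-neighbours p h =
        Adjacent-copy (image p) (image (suc p)) (H-Adjacent (vertexAt-Adjacent a x̂ p h))

      copyOf-image : ∀ p → 1 ≤ p → p < len a x → copyOf (image p) ≡ copyOf (image 1)
      copyOf-image (suc zero)    _ _ = refl
      copyOf-image (suc (suc q)) _ h =
        let (c , on₁ , on₂) = image-neighbours (suc q) (ℕP.<⇒≤ h)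
            q< = ℕP.<-trans (ℕP.n<1+n (suc q)) h
        in trans (trans (OnCopy⇒copyOf c _ (image-internal (suc (suc q)) (s≤s z≤n) h) on₂)
                        (sym (OnCopy⇒copyOf c _ (image-internal (suc q) (s≤s z≤n) q<) on₁)))
                 (copyOf-image (suc q) (s≤s z≤n) q<)

      first-copy : Σ Copy (λ c → proj₁ c ≡ d × copyOf (image 1) ≡ just c)
      first-copy =
        let (c , on₀ , on₁) = image-neighbours 0 (ℕP.<⇒≤ (1<len a x))
        in c , sym (OnCopy-vD c d (subst (OnCopy c) H-a on₀))
             , OnCopy⇒copyOf c _ (image-internal 1 (s≤s z≤n) (1<len a x)) on₁

      H-end : image (len a x) ≡ vD' ŷ
      H-end = trans (cong H (vertexAt-end a x̂)) H-x̂

      last-copy : Σ Copy (λ c → proj₂ c ≡ y × copyOf (image last) ≡ just c)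
      last-copy =
        let (c , on₀ , on₁) = image-neighbours last ℕP.≤-refl
        in c , sym (OnCopy-vD' c ŷ (subst (OnCopy c) H-end on₁))
             , OnCopy⇒copyOf c _ (image-internal last 1≤last ℕP.≤-refl) on₀

      copyOf-inner : ∀ q → suc q < len a x → copyOf (image (suc q)) ≡ just (d , y)
      copyOf-inner q h =
        let (c , c₁≡d , first) = first-copy
            (c' , c'₂≡y , last≡) = last-copy
            c≡c' = just-injective (trans (sym first) (trans (sym (copyOf-image last 1≤last ℕP.≤-refl)) last≡))
        in trans (copyOf-image (suc q) (s≤s z≤n) h)
             (trans first (cong just (cong₂ _,_ c₁≡d (trans (cong proj₂ c≡c') c'₂≡y))))

      image-OnCopy : ∀ p → p ≤ len a x → OnCopy (d , y) (image p)
      image-OnCopy zero    _ = 0 , subst (λ w → posIn d y w ≡ just 0) (sym H-a) (posIn-start d y)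
      image-OnCopy (suc q) h with ℕP.m≤n⇒m<n∨m≡n h
      ... | inj₁ lt   = copyOf⇒OnCopy (d , y) (image (suc q)) (copyOf-inner q lt)
      ... | inj₂ refl = len d y , subst (λ w → posIn d y w ≡ just (len d y)) (sym H-end) (posIn-end d ŷ)

      W : ℕ → ℕ
      W p = fromMaybe 0 (posIn d y (image p))

      posIn-image : ∀ p → p ≤ len a x → posIn d y (image p) ≡ just (W p)
      posIn-image p h with image-OnCopy p h
      ... | q , e rewrite e = refl

      W-0 : W 0 ≡ 0
      W-0 = cong (fromMaybe 0) (trans (cong (posIn d y) H-a) (posIn-start d y))

      W-arc : ∀ p q → Arc (arcs a x) p q → Arc (arcs d y) (W p) (W q)
      W-arc p q pq = subst₂ (Arc (arcs d y)) (just-injective (trans (sym at-u′) (posIn-image p p≤)))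
                       (just-injective (trans (sym at-v′) (posIn-image q q≤))) arc′
        where
        p≤ = proj₁ (Arc-endpoints-≤ pq)
        q≤ = proj₂ (Arc-endpoints-≤ pq)
        I = edge-elim (image p) (image q) (H-edge _ _ (Arc⇒edge a x̂ p q pq))
        open EdgeOnCopy I
        copy≡ : copy ≡ (d , y)
        copy≡ with internal
        ... | inj₁ i = just-injective (trans (sym (OnCopy⇒copyOf copy _ i (pos-u , at-u)))
                                             (OnCopy⇒copyOf (d , y) _ i (image-OnCopy p p≤)))
        ... | inj₂ i = just-injective (trans (sym (OnCopy⇒copyOf copy _ i (pos-v , at-v)))
                                             (OnCopy⇒copyOf (d , y) _ i (image-OnCopy q q≤)))
        at-u′ : posIn d y (image p) ≡ just pos-u
        at-u′ = subst (λ c → posIn (proj₁ c) (proj₂ c) (image p) ≡ just pos-u) copy≡ at-u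
        at-v′ : posIn d y (image q) ≡ just pos-v
        at-v′ = subst (λ c → posIn (proj₁ c) (proj₂ c) (image q) ≡ just pos-v) copy≡ at-v
        arc′ : Arc (arcs d y) pos-u pos-v
        arc′ = subst (λ c → Arc (arcs (proj₁ c) (proj₂ c)) pos-u pos-v) copy≡ arc

      W-arc-Q : ∀ p q → Arc (true ∷ pathArcs (flags a x)) p q → Arc (true ∷ pathArcs (flags d y)) (W p) (W q)
      W-arc-Q p q =
        subst (λ L → Arc L (W p) (W q)) (arcs≡Q d y) ∘ W-arc p q ∘ subst (λ L → Arc L p q) (sym (arcs≡Q a x))

      same-length : List.length (flags a x) ≡ List.length (flags d y)
      same-length = trans (length-flags a x) (sym (length-flags d y))

      flags-image : flags a x ⊆ᵇ flags d y
      flags-image = Q-hom-⊆ᵇ _ _ W W-arc-Q W-0 same-length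

      W-identity : flags a x ≡ flags d y → ∀ p → p ≤ len a x → W p ≡ p
      W-identity e p h = Q-endo-identity _ _ W W-arc-Q W-0 same-length e p (subst (p ≤_) (len≡ a x) h)

    module _ (x₀ : D') where

      H-vD-restrict : ∀ a → H (vD a) ≡ vD (restrictD H a)
      H-vD-restrict a = let (d , e) = H-vD x₀ a in trans e (cong vD (sym (cong (toD a) e)))

      H-vD'-restrict : ∀ x̂ → Σ D' λ ŷ → H (vD' x̂) ≡ vD' ŷ × proj₁ ŷ ≡ Vec.map (restrictD H) (proj₁ x̂)
      H-vD'-restrict x̂ = ŷ , H-x̂ ,
        trans (sym (VecP.tabulate∘lookup y))
          (trans (VecP.tabulate-cong coordinate) (VecP.tabulate∘lookup (Vec.map (restrictD H) x)))
        where
        x = proj₁ x̂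
        ŷ = proj₁ (H-vD' x̂)
        H-x̂ = proj₂ (H-vD' x̂)
        y = proj₁ ŷ
        coordinate : ∀ i → lookup y i ≡ lookup (Vec.map (restrictD H) x) i
        coordinate i =
          trans (⊆ᵇ-lookup x y a (restrictD H a)
                  (ImageCopy.flags-image a x̂ _ ŷ (H-vD-restrict a) H-x̂) i refl)
                (sym (VecP.lookup-map i (restrictD H) x))
          where a = lookup x i

      restrict-identity⇒identity : (∀ a → restrictD H a ≡ a) → ∀ v → H v ≡ v
      restrict-identity⇒identity r-id (vD a)     = trans (H-vD-restrict a) (cong vD (r-id a))
      restrict-identity⇒identity r-id (vD' x̂)    =
        let (ŷ , H-x̂ , ŷ≡) = H-vD'-restrict x̂ in
        trans H-x̂ (cong vD' (D'-≡ _ _ (trans ŷ≡ (trans (VecP.map-cong r-id _) (VecP.map-id _)))))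
      restrict-identity⇒identity r-id (vE a x̂ k) =
        posIn-injective a x _ _ p (subst (λ w → posIn a x (H w) ≡ just p) at-p image-at) (posIn-inner a x̂ k)
        where
        open ImageCopy a x̂ a x̂ (restrict-identity⇒identity r-id (vD a)) (restrict-identity⇒identity r-id (vD' x̂))
        p = suc (F.toℕ k)
        p≤ : p ≤ len a x
        p≤ = s≤s (ℕP.<⇒≤ (FP.toℕ<n k))
        at-p : vertexAt a x̂ p ≡ vE a x̂ k
        at-p = posIn-injective a x _ _ p (posIn-vertexAt a x̂ p p≤) (posIn-inner a x̂ k)
        image-at : posIn a x (H (vertexAt a x̂ p)) ≡ just p
        image-at = trans (posIn-image p p≤) (cong just (W-identity refl p p≤))

  -- Restricting a fractional polymorphism of Γₑ to D

  restrict : Op V 1 → Op (Fin n) 1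
  restrict h (a ∷ []) = restrictD (fun₁ h) a

  pol⇒IsEndo : ∀ h → IsPol Γe h → IsEndo (fun₁ h)
  pol⇒IsEndo h (𝔻-pol ∷ _) u v e =
    edge-feasible (fun₁ h u) (fun₁ h v) (𝔻-pol ((u ∷ v ∷ []) ∷ []) (feasible-edge u v e VAll.∷ VAll.[]))

  module _ (ni : NoneInfinite Γ) where

    x₀ : D'
    x₀ = combined-feasible Γ ni

    pol-vD'-restrict : ∀ h → IsPol Γe h → ∀ x̂ →
      Σ D' λ ŷ → fun₁ h (vD' x̂) ≡ vD' ŷ × proj₁ ŷ ≡ Vec.map (fun₁ (restrict h)) (proj₁ x̂)
    pol-vD'-restrict h h-pol = Endomorphism.H-vD'-restrict (fun₁ h) (pol⇒IsEndo h h-pol) x₀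

    restrict-pol : ∀ h → IsPol Γe h → IsPol Γ (restrict h)
    restrict-pol h h-pol = preservesCombined⇒pol Γ (restrict h) ni λ x fx →
      let (ŷ , _ , ŷ≡) = pol-vD'-restrict h h-pol (x , fx) in subst (Feas φΓ) ŷ≡ (proj₂ ŷ)

    φΓ-restrict≡μΓ : ∀ h → IsPol Γe h → ∀ x̂ →
                  φΓ (apply (restrict h) (proj₁ x̂ ∷ [])) ≡ μΓ (apply h ((vD' x̂ ∷ []) ∷ []))
    φΓ-restrict≡μΓ h h-pol x̂ =
      let (ŷ , H-x̂ , ŷ≡) = pol-vD'-restrict h h-pol x̂ in
      trans (cong φΓ (trans (apply-unary (restrict h) (proj₁ x̂)) (sym ŷ≡)))
            (sym (cong (λ w → μΓ (w ∷ [])) H-x̂))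

    restrictFracPol : FracPol Γe 1 → FracPol Γ 1
    restrictFracPol ω = record
      { dist  = ds
      ; pol   = AllP.map⁺ (All.map (restrict-pol _) (pol ω))
      ; pos   = AllP.map⁺ (pos ω)
      ; total = ds-total
      ; ineq  = combinedIneq⇒unaryIneqs Γ ds ni (All.map ℚP.<⇒≤ (AllP.map⁺ (pos ω))) ds-total
                  combined-ineq }
      where
      ds = mapOps restrict (dist ω)
      ds-total = trans (cong sumℚ (weights-mapOps restrict (dist ω))) (total ω)
      μ-ineq : UnaryIneq (dist ω) μΓ
      μ-ineq = All.lookup (ineq ω) (there (here refl))
      -- The inequality for μΓ at x ∈ D′ is the inequality for φΓ at x.
      combined-ineq : CombinedIneq Γ ds
      combined-ineq x fx =
        subst₂ _≤∞_ (sym (expect-mapOps restrict (dist ω) φΓ (x ∷ []) μΓ ((vD' (x , fx) ∷ []) ∷ [])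
                           (All.map (λ {e} h-pol → φΓ-restrict≡μΓ (proj₁ e) h-pol (x , fx)) (pol ω))))
                    (average-singleton (φΓ x))
          (μ-ineq ((vD' (x , fx) ∷ []) ∷ []) (fx VAll.∷ VAll.[]))

    rigidCore-Γ⇒Γe : RigidCore Γ → RigidCore Γe
    rigidCore-Γ⇒Γe rigid h (ω , h∈ω) v =
      let (h' , h'-pol , h'≗h , restrict-h'∈ω) = Any-mapOps restrict (dist ω) (pol ω) h∈ω
          r-id = rigid (restrict h') (restrictFracPol ω , restrict-h'∈ω)
      in trans (sym (h'≗h (v ∷ [])))
           (Endomorphism.restrict-identity⇒identity (fun₁ h') (pol⇒IsEndo h' h'-pol) x₀ r-id v)

lemma5p7 : {n : ℕ} (Γ : Lang (Fin n)) → NoneInfinite Γ →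
           RigidCore Γ ⇔ RigidCore (ExtendedDual.Γe Γ)
lemma5p7 Γ ni = mk⇔ (rigidCore-Γ⇒Γe ni) rigidCore-Γe⇒Γ
  where open ExtendedDualProperties Γ
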